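{- Let $p$ be a prime with $p\equiv5\pmod8$, and let $$G_p(x)=\prod_{1\le r\le p-1,\ (\frac rp)=1}\left(x-e^{2\pi ir/p}\right),\qquad G^*_p(x)=\prod_{1\le r\le p-1,\ (\frac rp)=-1}\left(x-e^{2\pi ir/p}\right).$$ Then $G_p(x)\in\mathbb{R}[x]$ and $G_p(x^2)=G_p^*(x)\,G_p^*(-x)$.
   Context: $\left(\frac{\cdot}{p}\right)$ denotes the Legendre symbol modulo $p$. -}

module Defs where

open import Data.Bool using (Bool; true; false; if_then_else_)
open import Data.Nat as ℕ using (ℕ; zero; suc; NonZero; _≡ᵇ_; _∸_)
open import Data.Nat.DivMod using (_%_; _mod_)
open import Data.Fin as Fin using (Fin; toℕ)
open import Data.Integer as ℤ using (ℤ; +_; 0ℤ; 1ℤ; -1ℤ; _≟_)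
open import Data.List as List using (List; []; _∷_; upTo; map; filter; foldr)
open import Data.Bool.ListAction using (any)
open import Data.List.Relation.Unary.All using (All)
open import Data.Product using (Σ; _×_)
open import Data.Unit using (⊤)
open import Relation.Binary.PropositionalEquality using (_≡_)

isSquareMod : (p : ℕ) .{{_ : NonZero p}} → ℕ → Bool
isSquareMod p r = any (λ x → ((x ℕ.* x) % p) ≡ᵇ (r % p)) (upTo p)

legendre : ℕ → (p : ℕ) .{{_ : NonZero p}} → ℤ
legendre r p =
  if (r % p) ≡ᵇ 0 then 0ℤ else (if isSquareMod p r then 1ℤ else -1ℤ)

-- The ring ℤ[ζ_p] ⊂ ℂ, ζ_p = e^{2πi/p}, p prime.
-- An element is a vector (a_0,…,a_{p-1}) ∈ ℤ^p representing Σ a_k ζ^k.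
-- Since 1 + ζ + … + ζ^{p-1} = 0 is the only relation (p prime), two
-- vectors denote the same complex number iff their difference is constant.

Cyc : ℕ → Set
Cyc p = Fin p → ℤ

sumFin : ∀ {n} → (Fin n → ℤ) → ℤ
sumFin {zero}  f = 0ℤ
sumFin {suc n} f = f Fin.zero ℤ.+ sumFin (λ i → f (Fin.suc i))

module _ (p : ℕ) .{{_ : NonZero p}} where

  _≈C_ : Cyc p → Cyc p → Set
  a ≈C b = Σ ℤ (λ c → ∀ k → a k ℤ.- b k ≡ c)

  0C : Cyc p
  0C _ = 0ℤ

  ζ^ : ℕ → Cyc p
  ζ^ r k = if toℕ k ≡ᵇ toℕ (r mod p) then 1ℤ else 0ℤ

  1C : Cyc p
  1C = ζ^ 0

  _+C_ : Cyc p → Cyc p → Cyc p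
  (a +C b) k = a k ℤ.+ b k

  -C_ : Cyc p → Cyc p
  (-C a) k = ℤ.- a k

  _*C_ : Cyc p → Cyc p → Cyc p
  (a *C b) k = sumFin (λ i → a i ℤ.* b ((toℕ k ℕ.+ p ∸ toℕ i) mod p))

  conj : Cyc p → Cyc p
  conj a k = a ((p ∸ toℕ k) mod p)

  IsReal : Cyc p → Set
  IsReal a = conj a ≈C a

  -- Polynomials over ℤ[ζ_p]: coefficient lists, lowest degree first.

  Poly : Set
  Poly = List (Cyc p)

  _≈P_ : Poly → Poly → Set
  []       ≈P []       = ⊤
  []       ≈P (b ∷ bs) = (0C ≈C b) × ([] ≈P bs)
  (a ∷ as) ≈P []       = (a ≈C 0C) × (as ≈P [])
  (a ∷ as) ≈P (b ∷ bs) = (a ≈C b) × (as ≈P bs)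

  _+P_ : Poly → Poly → Poly
  []       +P q        = q
  (a ∷ as) +P []       = a ∷ as
  (a ∷ as) +P (b ∷ bs) = (a +C b) ∷ (as +P bs)

  _*P_ : Poly → Poly → Poly
  []       *P q = []
  (a ∷ as) *P q = map (a *C_) q +P (0C ∷ (as *P q))

  negX : Poly → Poly
  negX []       = []
  negX (a ∷ as) = a ∷ map -C_ (negX as)

  sqX : Poly → Poly
  sqX []       = []
  sqX (a ∷ as) = a ∷ 0C ∷ sqX as

  linFactor : ℕ → Poly
  linFactor r = (-C ζ^ r) ∷ 1C ∷ []

  prodP : List Poly → Poly
  prodP = foldr _*P_ (1C ∷ [])

  residues : List ℕ
  residues = map suc (upTo (p ∸ 1))

  G : Poly
  G = prodP (map linFactor (filter (λ r → legendre r p ≟ 1ℤ) residues))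

  G* : Poly
  G* = prodP (map linFactor (filter (λ r → legendre r p ≟ -1ℤ) residues))

  IsRealPoly : Poly → Set
  IsRealPoly f = All IsReal f

{-# OPTIONS --safe #-}
-- Let Q and N be the quadratic residues and non-residues mod p, and ζ = e^{2πi/p}. Conjugation
-- sends x − ζ^r to x − ζ^{−r}; as p ≡ 1 (mod 4), −1 is a square, so r ↦ −r permutes Q and G_p is
-- real. Since (x − ζ^n)(−x − ζ^n) = −(x² − ζ^{2n}), G*_p(x) G*_p(−x) = (−1)^|N| ∏_{n∈N} (x² − ζ^{2n}),
-- where |N| = (p − 1)/2 is even; as p ≡ 5 (mod 8), 2 is a non-square, so n ↦ 2n maps N onto Q and
-- the product is G_p(x²). The facts about −1, 2 and products of non-squares come from Euler's
-- criterion, proved like Wilson's theorem by pairing each unit x with a/x in (p − 1)!, and from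
-- Gauss's computation 2^h h! = 2·4⋯2h ≡ (−1)^{h/2} h! for h = (p − 1)/2.
module Submission where

open import Defs
open import Data.Nat using (ℕ; NonZero)
open import Data.Nat.DivMod using (_%_)
open import Data.Nat.Primality using (Prime)
open import Data.Product using (_×_)
open import Relation.Binary.PropositionalEquality using (_≡_)

open import Level using (0ℓ)
open import Algebra.Bundles using (CommutativeRing; CommutativeMonoid)
open import Algebra.Morphism.Structures using (module RingMorphisms)
open import Algebra.Structures using (IsCommutativeRing; IsCommutativeMonoid)
open import Data.Bool using (Bool; true; false; if_then_else_; T)
open import Data.Empty using (⊥-elim)
open import Data.Fin as Fin using (Fin; toℕ)
open import Data.Fin.Properties using (toℕ-injective; toℕ-fromℕ<; toℕ<n)
open import Data.Integer as ℤ using (ℤ; 0ℤ; 1ℤ; -1ℤ)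
import Data.Integer.Properties as ℤₚ
open import Data.List using (List; []; _∷_; _++_; map; foldr; length; filter; upTo)
open import Data.List.Properties using (map-∘; length-map; filter-all)
open import Data.List.Membership.Propositional using (_∈_)
open import Data.List.Membership.Propositional.Properties using (∈-map⁺; ∈-map⁻; ∈-∃++; ∈-filter⁺; ∈-filter⁻)
open import Data.List.Membership.Propositional.Properties.WithK using (unique∧set⇒bag)
open import Data.List.Relation.Binary.BagAndSetEquality using (∼bag⇒↭)
open import Data.List.Relation.Binary.Permutation.Propositional using (_↭_; ↭-sym; ↭⇒↭ₛ; ↭⇒↭ₛ′)
open import Data.List.Relation.Binary.Permutation.Propositional.Properties
  using (map⁺; ↭-length; ∈-resp-↭) renaming (shift to ↭-shift)
open import Data.List.Relation.Unary.All as All using (All; []; _∷_)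
import Data.List.Relation.Unary.All.Properties as All
open import Data.List.Relation.Unary.AllPairs using ([]; _∷_)
open import Data.List.Relation.Unary.Any using (here; there)
open import Data.List.Relation.Unary.Unique.Propositional using (Unique)
import Data.List.Relation.Unary.Unique.Propositional.Properties as Unique
open import Data.Nat as ℕ using (zero; suc)
open import Data.Nat.DivMod
  using (_mod_; _/_; m≡m%n+[m/n]*n; m%n%n≡m%n; %-distribˡ-+; %-distribˡ-*; n%n≡0; m*n%n≡0; m<n⇒m%n≡m; m%n≤n; m%n<n)
open import Data.Nat.ListAction using (product)
open import Data.Nat.ListAction.Properties using (product-↭)
open import Data.Product using (Σ; ∃-syntax; _,_; proj₁; proj₂)
open import Data.Sum using (_⊎_; inj₁; inj₂; [_,_]′)
open import Data.Unit using (tt)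
open import Function using (_∘_)
open import Function.Bundles using (_⇔_; mk⇔)
open import Relation.Binary.Bundles using (Setoid)
import Relation.Binary.Construct.On as On
open import Relation.Binary.PropositionalEquality as ≡ using (_≢_; _≗_)
import Relation.Binary.Reasoning.Setoid as SetoidReasoning
open import Relation.Nullary using (¬_; ¬?; yes; no; contradiction)
open import Relation.Unary using (Decidable)

module Polynomial {c ℓ} (R : CommutativeRing c ℓ) where

  open import Data.Nat.Properties using (suc-injective; +-suc; 0≢1+n)
  open ≡ using (cong) renaming (trans to ≡-trans)

  open CommutativeRing R hiding (zero)
  open import Algebra.Properties.Ring ring using (-‿distribˡ-*; -‿distribʳ-*; -‿involutive; -0#≈0#; -1*x≈-x; -‿+-comm)
  open import Relation.Binary.Structures using (IsEquivalence)
  open RingMorphisms using (IsRingHomomorphism)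

  infix  4 _≈ₚ_
  infixl 6 _+ₚ_
  infixl 7 _*ₚ_

  coeff : List Carrier → ℕ → Carrier
  coeff []      _       = 0#
  coeff (a ∷ f) zero    = a
  coeff (a ∷ f) (suc i) = coeff f i

  record _≈ₚ_ (f g : List Carrier) : Set ℓ where
    constructor mk≈ₚ
    field coeff-≈ : ∀ i → coeff f i ≈ coeff g i
  open _≈ₚ_ public

  ≈ₚ-isEquivalence : IsEquivalence _≈ₚ_
  ≈ₚ-isEquivalence = record
    { refl  = mk≈ₚ λ i → refl
    ; sym   = λ f≈g → mk≈ₚ λ i → sym (coeff-≈ f≈g i)
    ; trans = λ f≈g g≈h → mk≈ₚ λ i → trans (coeff-≈ f≈g i) (coeff-≈ g≈h i)
    }

  ≈ₚ-setoid : Setoid c ℓ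
  ≈ₚ-setoid = record { isEquivalence = ≈ₚ-isEquivalence }

  open IsEquivalence ≈ₚ-isEquivalence public
    renaming (refl to ≈ₚ-refl; sym to ≈ₚ-sym; trans to ≈ₚ-trans; reflexive to ≈ₚ-reflexive)

  module ≈ₚ-Reasoning = SetoidReasoning ≈ₚ-setoid

  ∷-cong : ∀ {a b f g} → a ≈ b → f ≈ₚ g → a ∷ f ≈ₚ b ∷ g
  ∷-cong a≈b f≈g = mk≈ₚ λ { zero → a≈b ; (suc i) → coeff-≈ f≈g i }

  ∷-injective : ∀ {a b f g} → a ∷ f ≈ₚ b ∷ g → a ≈ b × f ≈ₚ g
  ∷-injective e = coeff-≈ e zero , mk≈ₚ λ i → coeff-≈ e (suc i)

  ∷≈[] : ∀ {a f} → a ≈ 0# → f ≈ₚ [] → a ∷ f ≈ₚ []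
  ∷≈[] a≈0 f≈[] = mk≈ₚ λ { zero → a≈0 ; (suc i) → coeff-≈ f≈[] i }

  ∷≈[]⁻¹ : ∀ {a f} → a ∷ f ≈ₚ [] → a ≈ 0# × f ≈ₚ []
  ∷≈[]⁻¹ e = coeff-≈ e zero , mk≈ₚ λ i → coeff-≈ e (suc i)

  _+ₚ_ : List Carrier → List Carrier → List Carrier
  []      +ₚ g       = g
  (a ∷ f) +ₚ []      = a ∷ f
  (a ∷ f) +ₚ (b ∷ g) = (a + b) ∷ (f +ₚ g)

  scale : Carrier → List Carrier → List Carrier
  scale a = map (a *_)

  _*ₚ_ : List Carrier → List Carrier → List Carrier
  []      *ₚ g = []
  (a ∷ f) *ₚ g = scale a g +ₚ (0# ∷ f *ₚ g)

  1ₚ : List Carrier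
  1ₚ = 1# ∷ []

  -ₚ_ : List Carrier → List Carrier
  -ₚ_ = map (-_)

  coeff-+ₚ : ∀ f g i → coeff (f +ₚ g) i ≈ coeff f i + coeff g i
  coeff-+ₚ []      g       i       = sym (+-identityˡ (coeff g i))
  coeff-+ₚ (a ∷ f) []      i       = sym (+-identityʳ (coeff (a ∷ f) i))
  coeff-+ₚ (a ∷ f) (b ∷ g) zero    = refl
  coeff-+ₚ (a ∷ f) (b ∷ g) (suc i) = coeff-+ₚ f g i

  coeff-map : ∀ {φ : Carrier → Carrier} → φ 0# ≈ 0# → ∀ f i → coeff (map φ f) i ≈ φ (coeff f i)
  coeff-map φ0≈0 []      i       = sym φ0≈0
  coeff-map φ0≈0 (a ∷ f) zero    = refl
  coeff-map φ0≈0 (a ∷ f) (suc i) = coeff-map φ0≈0 f i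

  coeff-scale : ∀ a f i → coeff (scale a f) i ≈ a * coeff f i
  coeff-scale a = coeff-map (zeroʳ a)

  coeff--ₚ : ∀ f i → coeff (-ₚ f) i ≈ - coeff f i
  coeff--ₚ = coeff-map -0#≈0#

  +ₚ-cong : ∀ {f f′ g g′} → f ≈ₚ f′ → g ≈ₚ g′ → f +ₚ g ≈ₚ f′ +ₚ g′
  +ₚ-cong {f} {f′} {g} {g′} f≈f′ g≈g′ = mk≈ₚ λ i → begin
    coeff (f +ₚ g) i          ≈⟨ coeff-+ₚ f g i ⟩
    coeff f i + coeff g i     ≈⟨ +-cong (coeff-≈ f≈f′ i) (coeff-≈ g≈g′ i) ⟩
    coeff f′ i + coeff g′ i   ≈⟨ coeff-+ₚ f′ g′ i ⟨
    coeff (f′ +ₚ g′) i        ∎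
    where open SetoidReasoning setoid

  +ₚ-assoc : ∀ f g h → f +ₚ g +ₚ h ≈ₚ f +ₚ (g +ₚ h)
  +ₚ-assoc f g h = mk≈ₚ λ i → begin
    coeff (f +ₚ g +ₚ h) i                  ≈⟨ trans (coeff-+ₚ (f +ₚ g) h i) (+-congʳ (coeff-+ₚ f g i)) ⟩
    coeff f i + coeff g i + coeff h i      ≈⟨ +-assoc (coeff f i) (coeff g i) (coeff h i) ⟩
    coeff f i + (coeff g i + coeff h i)    ≈⟨ trans (coeff-+ₚ f (g +ₚ h) i) (+-congˡ (coeff-+ₚ g h i)) ⟨
    coeff (f +ₚ (g +ₚ h)) i                ∎
    where open SetoidReasoning setoid

  +ₚ-comm : ∀ f g → f +ₚ g ≈ₚ g +ₚ f
  +ₚ-comm f g = mk≈ₚ λ i →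
    trans (coeff-+ₚ f g i) (trans (+-comm (coeff f i) (coeff g i)) (sym (coeff-+ₚ g f i)))

  +ₚ-identityʳ : ∀ f → f +ₚ [] ≈ₚ f
  +ₚ-identityʳ f = mk≈ₚ λ i → trans (coeff-+ₚ f [] i) (+-identityʳ (coeff f i))

  +ₚ-isCommutativeMonoid : IsCommutativeMonoid _≈ₚ_ _+ₚ_ []
  +ₚ-isCommutativeMonoid = record
    { isMonoid = record
      { isSemigroup = record
        { isMagma = record { isEquivalence = ≈ₚ-isEquivalence ; ∙-cong = +ₚ-cong }
        ; assoc   = +ₚ-assoc
        }
      ; identity = (λ f → ≈ₚ-refl) , +ₚ-identityʳ
      }
    ; comm = +ₚ-comm
    }

  +ₚ-commutativeMonoid : CommutativeMonoid c ℓ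
  +ₚ-commutativeMonoid = record { isCommutativeMonoid = +ₚ-isCommutativeMonoid }

  open import Algebra.Properties.CommutativeSemigroup (CommutativeMonoid.commutativeSemigroup +ₚ-commutativeMonoid)
    using () renaming (interchange to +ₚ-interchange; x∙yz≈y∙xz to +ₚ-swapˡ)

  scale-cong : ∀ {a a′ f f′} → a ≈ a′ → f ≈ₚ f′ → scale a f ≈ₚ scale a′ f′
  scale-cong {a} {a′} {f} {f′} a≈a′ f≈f′ = mk≈ₚ λ i →
    trans (coeff-scale a f i) (trans (*-cong a≈a′ (coeff-≈ f≈f′ i)) (sym (coeff-scale a′ f′ i)))

  scale-distribˡ : ∀ a f g → scale a (f +ₚ g) ≈ₚ scale a f +ₚ scale a g
  scale-distribˡ a f g = mk≈ₚ λ i → begin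
    coeff (scale a (f +ₚ g)) i             ≈⟨ trans (coeff-scale a (f +ₚ g) i) (*-congˡ (coeff-+ₚ f g i)) ⟩
    a * (coeff f i + coeff g i)            ≈⟨ distribˡ a (coeff f i) (coeff g i) ⟩
    a * coeff f i + a * coeff g i
      ≈⟨ trans (coeff-+ₚ (scale a f) (scale a g) i) (+-cong (coeff-scale a f i) (coeff-scale a g i)) ⟨
    coeff (scale a f +ₚ scale a g) i       ∎
    where open SetoidReasoning setoid

  scale-distribʳ : ∀ a b f → scale (a + b) f ≈ₚ scale a f +ₚ scale b f
  scale-distribʳ a b f = mk≈ₚ λ i → begin
    coeff (scale (a + b) f) i              ≈⟨ coeff-scale (a + b) f i ⟩
    (a + b) * coeff f i                    ≈⟨ distribʳ (coeff f i) a b ⟩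
    a * coeff f i + b * coeff f i
      ≈⟨ trans (coeff-+ₚ (scale a f) (scale b f) i) (+-cong (coeff-scale a f i) (coeff-scale b f i)) ⟨
    coeff (scale a f +ₚ scale b f) i       ∎
    where open SetoidReasoning setoid

  scale-scale : ∀ a b f → scale a (scale b f) ≈ₚ scale (a * b) f
  scale-scale a b f = mk≈ₚ λ i → begin
    coeff (scale a (scale b f)) i   ≈⟨ trans (coeff-scale a (scale b f) i) (*-congˡ (coeff-scale b f i)) ⟩
    a * (b * coeff f i)             ≈⟨ *-assoc a b (coeff f i) ⟨
    a * b * coeff f i               ≈⟨ coeff-scale (a * b) f i ⟨
    coeff (scale (a * b) f) i       ∎
    where open SetoidReasoning setoid

  scale-identity : ∀ f → scale 1# f ≈ₚ f
  scale-identity f = mk≈ₚ λ i → trans (coeff-scale 1# f i) (*-identityˡ (coeff f i))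

  scale-zero : ∀ {a} f → a ≈ 0# → scale a f ≈ₚ []
  scale-zero {a} f a≈0 = mk≈ₚ λ i → trans (coeff-scale a f i) (trans (*-congʳ a≈0) (zeroˡ (coeff f i)))

  -ₚ≈scale : ∀ f → -ₚ f ≈ₚ scale (- 1#) f
  -ₚ≈scale f = mk≈ₚ λ i → trans (coeff--ₚ f i) (trans (sym (-1*x≈-x (coeff f i))) (sym (coeff-scale (- 1#) f i)))

  0∷-*ₚ : ∀ f g → (0# ∷ f) *ₚ g ≈ₚ 0# ∷ f *ₚ g
  0∷-*ₚ f g = +ₚ-cong (scale-zero g refl) ≈ₚ-refl

  *ₚ-zeroʳ : ∀ f → f *ₚ [] ≈ₚ []
  *ₚ-zeroʳ []      = ≈ₚ-refl
  *ₚ-zeroʳ (a ∷ f) = ∷≈[] refl (*ₚ-zeroʳ f)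

  *ₚ-zeroˡ-≈ : ∀ {f} g → f ≈ₚ [] → f *ₚ g ≈ₚ []
  *ₚ-zeroˡ-≈ {[]}    g f≈[] = ≈ₚ-refl
  *ₚ-zeroˡ-≈ {a ∷ f} g a∷f≈[] =
    ≈ₚ-trans (+ₚ-cong (scale-zero g a≈0) (∷-cong refl (*ₚ-zeroˡ-≈ g f≈[]))) (∷≈[] refl ≈ₚ-refl)
    where open Σ (∷≈[]⁻¹ a∷f≈[]) renaming (proj₁ to a≈0; proj₂ to f≈[])

  *ₚ-congʳ : ∀ f {g g′} → g ≈ₚ g′ → f *ₚ g ≈ₚ f *ₚ g′
  *ₚ-congʳ []      g≈g′ = ≈ₚ-refl
  *ₚ-congʳ (a ∷ f) g≈g′ = +ₚ-cong (scale-cong refl g≈g′) (∷-cong refl (*ₚ-congʳ f g≈g′))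

  *ₚ-congˡ : ∀ {f f′} g → f ≈ₚ f′ → f *ₚ g ≈ₚ f′ *ₚ g
  *ₚ-congˡ {[]}    {f′}     g []≈f′ = ≈ₚ-sym (*ₚ-zeroˡ-≈ g (≈ₚ-sym []≈f′))
  *ₚ-congˡ {a ∷ f} {[]}     g f≈[]  = *ₚ-zeroˡ-≈ g f≈[]
  *ₚ-congˡ {a ∷ f} {b ∷ f′} g e     = +ₚ-cong (scale-cong a≈b ≈ₚ-refl) (∷-cong refl (*ₚ-congˡ g f≈f′))
    where open Σ (∷-injective e) renaming (proj₁ to a≈b; proj₂ to f≈f′)

  *ₚ-cong : ∀ {f f′ g g′} → f ≈ₚ f′ → g ≈ₚ g′ → f *ₚ g ≈ₚ f′ *ₚ g′
  *ₚ-cong {f′ = f′} {g} f≈f′ g≈g′ = ≈ₚ-trans (*ₚ-congˡ g f≈f′) (*ₚ-congʳ f′ g≈g′)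

  *ₚ-distribʳ : ∀ h f g → (f +ₚ g) *ₚ h ≈ₚ f *ₚ h +ₚ g *ₚ h
  *ₚ-distribʳ h []      g       = ≈ₚ-refl
  *ₚ-distribʳ h (a ∷ f) []      = ≈ₚ-sym (+ₚ-identityʳ _)
  *ₚ-distribʳ h (a ∷ f) (b ∷ g) = begin
    scale (a + b) h +ₚ (0# ∷ (f +ₚ g) *ₚ h)
      ≈⟨ +ₚ-cong (scale-distribʳ a b h) (∷-cong (sym (+-identityˡ 0#)) (*ₚ-distribʳ h f g)) ⟩
    (scale a h +ₚ scale b h) +ₚ ((0# ∷ f *ₚ h) +ₚ (0# ∷ g *ₚ h))
      ≈⟨ +ₚ-interchange (scale a h) (scale b h) (0# ∷ f *ₚ h) (0# ∷ g *ₚ h) ⟩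
    (scale a h +ₚ (0# ∷ f *ₚ h)) +ₚ (scale b h +ₚ (0# ∷ g *ₚ h))
      ∎
    where open ≈ₚ-Reasoning

  scale-*ₚ : ∀ a f g → scale a f *ₚ g ≈ₚ scale a (f *ₚ g)
  scale-*ₚ a []      g = ≈ₚ-refl
  scale-*ₚ a (b ∷ f) g = begin
    scale (a * b) g +ₚ (0# ∷ scale a f *ₚ g)
      ≈⟨ +ₚ-cong (≈ₚ-sym (scale-scale a b g)) (∷-cong (sym (zeroʳ a)) (scale-*ₚ a f g)) ⟩
    scale a (scale b g) +ₚ scale a (0# ∷ f *ₚ g)
      ≈⟨ scale-distribˡ a (scale b g) (0# ∷ f *ₚ g) ⟨
    scale a (scale b g +ₚ (0# ∷ f *ₚ g))
      ∎
    where open ≈ₚ-Reasoning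

  *ₚ-scale : ∀ a f g → f *ₚ scale a g ≈ₚ scale a (f *ₚ g)
  *ₚ-scale a []      g = ≈ₚ-refl
  *ₚ-scale a (b ∷ f) g = begin
    scale b (scale a g) +ₚ (0# ∷ f *ₚ scale a g)
      ≈⟨ +ₚ-cong scale-swap (∷-cong (sym (zeroʳ a)) (*ₚ-scale a f g)) ⟩
    scale a (scale b g) +ₚ scale a (0# ∷ f *ₚ g)
      ≈⟨ scale-distribˡ a (scale b g) (0# ∷ f *ₚ g) ⟨
    scale a (scale b g +ₚ (0# ∷ f *ₚ g))
      ∎
    where
    open ≈ₚ-Reasoning
    scale-swap : scale b (scale a g) ≈ₚ scale a (scale b g)
    scale-swap = ≈ₚ-trans (scale-scale b a g) (≈ₚ-trans (scale-cong (*-comm b a) ≈ₚ-refl) (≈ₚ-sym (scale-scale a b g)))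

  *ₚ-∷ : ∀ g a f → g *ₚ (a ∷ f) ≈ₚ scale a g +ₚ (0# ∷ g *ₚ f)
  *ₚ-∷ []      a f = ≈ₚ-sym (∷≈[] refl ≈ₚ-refl)
  *ₚ-∷ (b ∷ g) a f = begin
    ((b * a) ∷ scale b f) +ₚ (0# ∷ g *ₚ (a ∷ f))
      ≈⟨ +ₚ-cong (≈ₚ-refl {(b * a) ∷ scale b f}) (∷-cong refl (*ₚ-∷ g a f)) ⟩
    ((b * a) + 0#) ∷ (scale b f +ₚ (scale a g +ₚ (0# ∷ g *ₚ f)))
      ≈⟨ ∷-cong (+-congʳ (*-comm b a)) (+ₚ-swapˡ (scale b f) (scale a g) (0# ∷ g *ₚ f)) ⟩
    ((a * b) + 0#) ∷ (scale a g +ₚ (scale b f +ₚ (0# ∷ g *ₚ f)))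
      ∎
    where open ≈ₚ-Reasoning

  *ₚ-comm : ∀ f g → f *ₚ g ≈ₚ g *ₚ f
  *ₚ-comm []      g = ≈ₚ-sym (*ₚ-zeroʳ g)
  *ₚ-comm (a ∷ f) g = ≈ₚ-trans (+ₚ-cong ≈ₚ-refl (∷-cong refl (*ₚ-comm f g))) (≈ₚ-sym (*ₚ-∷ g a f))

  *ₚ-assoc : ∀ f g h → f *ₚ g *ₚ h ≈ₚ f *ₚ (g *ₚ h)
  *ₚ-assoc []      g h = ≈ₚ-refl
  *ₚ-assoc (a ∷ f) g h = begin
    (scale a g +ₚ (0# ∷ f *ₚ g)) *ₚ h      ≈⟨ *ₚ-distribʳ h (scale a g) (0# ∷ f *ₚ g) ⟩
    scale a g *ₚ h +ₚ (0# ∷ f *ₚ g) *ₚ h   ≈⟨ +ₚ-cong (scale-*ₚ a g h) (0∷-*ₚ (f *ₚ g) h) ⟩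
    scale a (g *ₚ h) +ₚ (0# ∷ f *ₚ g *ₚ h) ≈⟨ +ₚ-cong ≈ₚ-refl (∷-cong refl (*ₚ-assoc f g h)) ⟩
    scale a (g *ₚ h) +ₚ (0# ∷ f *ₚ (g *ₚ h)) ∎
    where open ≈ₚ-Reasoning

  *ₚ-identityˡ : ∀ f → 1ₚ *ₚ f ≈ₚ f
  *ₚ-identityˡ f = ≈ₚ-trans (+ₚ-cong (scale-identity f) (∷≈[] refl ≈ₚ-refl)) (+ₚ-identityʳ f)

  *ₚ-isCommutativeMonoid : IsCommutativeMonoid _≈ₚ_ _*ₚ_ 1ₚ
  *ₚ-isCommutativeMonoid = record
    { isMonoid = record
      { isSemigroup = record
        { isMagma = record { isEquivalence = ≈ₚ-isEquivalence ; ∙-cong = *ₚ-cong }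
        ; assoc   = *ₚ-assoc
        }
      ; identity = *ₚ-identityˡ , λ f → ≈ₚ-trans (*ₚ-comm f 1ₚ) (*ₚ-identityˡ f)
      }
    ; comm = *ₚ-comm
    }

  *ₚ-commutativeMonoid : CommutativeMonoid c ℓ
  *ₚ-commutativeMonoid = record { isCommutativeMonoid = *ₚ-isCommutativeMonoid }

  open import Algebra.Properties.CommutativeSemigroup (CommutativeMonoid.commutativeSemigroup *ₚ-commutativeMonoid)
    using () renaming (interchange to *ₚ-interchange)
  open import Data.List.Relation.Binary.Permutation.Setoid.Properties ≈ₚ-setoid using (foldr-commMonoid)

  -x*-y≈x*y : ∀ x y → - x * - y ≈ x * y
  -x*-y≈x*y x y = begin
    - x * - y        ≈⟨ -‿distribˡ-* x (- y) ⟨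
    - (x * - y)      ≈⟨ -‿cong (-‿distribʳ-* x y) ⟨
    - (- (x * y))    ≈⟨ -‿involutive (x * y) ⟩
    x * y            ∎
    where open SetoidReasoning setoid

  -ₚ-cong : ∀ {f g} → f ≈ₚ g → -ₚ f ≈ₚ -ₚ g
  -ₚ-cong {f} {g} f≈g = mk≈ₚ λ i → trans (coeff--ₚ f i) (trans (-‿cong (coeff-≈ f≈g i)) (sym (coeff--ₚ g i)))

  -ₚ-+ₚ : ∀ f g → -ₚ (f +ₚ g) ≈ₚ -ₚ f +ₚ -ₚ g
  -ₚ-+ₚ f g = mk≈ₚ λ i → begin
    coeff (-ₚ (f +ₚ g)) i        ≈⟨ trans (coeff--ₚ (f +ₚ g) i) (-‿cong (coeff-+ₚ f g i)) ⟩
    - (coeff f i + coeff g i)    ≈⟨ -‿+-comm (coeff f i) (coeff g i) ⟨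
    - coeff f i + - coeff g i    ≈⟨ trans (coeff-+ₚ (-ₚ f) (-ₚ g) i) (+-cong (coeff--ₚ f i) (coeff--ₚ g i)) ⟨
    coeff (-ₚ f +ₚ -ₚ g) i       ∎
    where open SetoidReasoning setoid

  -ₚ-scale : ∀ a f → -ₚ scale a f ≈ₚ scale a (-ₚ f)
  -ₚ-scale a f = mk≈ₚ λ i → begin
    coeff (-ₚ scale a f) i     ≈⟨ trans (coeff--ₚ (scale a f) i) (-‿cong (coeff-scale a f i)) ⟩
    - (a * coeff f i)          ≈⟨ -‿distribʳ-* a (coeff f i) ⟩
    a * - coeff f i            ≈⟨ trans (coeff-scale a (-ₚ f) i) (*-congˡ (coeff--ₚ f i)) ⟨
    coeff (scale a (-ₚ f)) i   ∎
    where open SetoidReasoning setoid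

  -ₚ-*ₚ : ∀ f g → -ₚ f *ₚ g ≈ₚ -ₚ (f *ₚ g)
  -ₚ-*ₚ f g = ≈ₚ-trans (*ₚ-congˡ g (-ₚ≈scale f)) (≈ₚ-trans (scale-*ₚ (- 1#) f g) (≈ₚ-sym (-ₚ≈scale (f *ₚ g))))

  -ₚ-*ₚ--ₚ : ∀ f g → -ₚ f *ₚ -ₚ g ≈ₚ f *ₚ g
  -ₚ-*ₚ--ₚ f g = begin
    -ₚ f *ₚ -ₚ g                    ≈⟨ *ₚ-cong (-ₚ≈scale f) (-ₚ≈scale g) ⟩
    scale (- 1#) f *ₚ scale (- 1#) g ≈⟨ scale-*ₚ (- 1#) f (scale (- 1#) g) ⟩
    scale (- 1#) (f *ₚ scale (- 1#) g) ≈⟨ scale-cong refl (*ₚ-scale (- 1#) f g) ⟩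
    scale (- 1#) (scale (- 1#) (f *ₚ g)) ≈⟨ scale-scale (- 1#) (- 1#) (f *ₚ g) ⟩
    scale (- 1# * - 1#) (f *ₚ g)   ≈⟨ scale-cong (trans (-x*-y≈x*y 1# 1#) (*-identityˡ 1#)) ≈ₚ-refl ⟩
    scale 1# (f *ₚ g)              ≈⟨ scale-identity (f *ₚ g) ⟩
    f *ₚ g                         ∎
    where open ≈ₚ-Reasoning

  negXₚ : List Carrier → List Carrier
  negXₚ []      = []
  negXₚ (a ∷ f) = a ∷ -ₚ negXₚ f

  negXₚ-+ₚ : ∀ f g → negXₚ (f +ₚ g) ≈ₚ negXₚ f +ₚ negXₚ g
  negXₚ-+ₚ []      g       = ≈ₚ-refl
  negXₚ-+ₚ (a ∷ f) []      = ≈ₚ-refl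
  negXₚ-+ₚ (a ∷ f) (b ∷ g) = ∷-cong refl (≈ₚ-trans (-ₚ-cong (negXₚ-+ₚ f g)) (-ₚ-+ₚ (negXₚ f) (negXₚ g)))

  negXₚ-scale : ∀ a f → negXₚ (scale a f) ≈ₚ scale a (negXₚ f)
  negXₚ-scale a []      = ≈ₚ-refl
  negXₚ-scale a (b ∷ f) = ∷-cong refl (≈ₚ-trans (-ₚ-cong (negXₚ-scale a f)) (-ₚ-scale a (negXₚ f)))

  negXₚ-*ₚ : ∀ f g → negXₚ (f *ₚ g) ≈ₚ negXₚ f *ₚ negXₚ g
  negXₚ-*ₚ []      g = ≈ₚ-refl
  negXₚ-*ₚ (a ∷ f) g = begin
    negXₚ (scale a g +ₚ (0# ∷ f *ₚ g))
      ≈⟨ negXₚ-+ₚ (scale a g) (0# ∷ f *ₚ g) ⟩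
    negXₚ (scale a g) +ₚ (0# ∷ -ₚ negXₚ (f *ₚ g))
      ≈⟨ +ₚ-cong (negXₚ-scale a g) (∷-cong refl (-ₚ-cong (negXₚ-*ₚ f g))) ⟩
    scale a (negXₚ g) +ₚ (0# ∷ -ₚ (negXₚ f *ₚ negXₚ g))
      ≈⟨ +ₚ-cong ≈ₚ-refl (∷-cong refl (-ₚ-*ₚ (negXₚ f) (negXₚ g))) ⟨
    scale a (negXₚ g) +ₚ (0# ∷ -ₚ negXₚ f *ₚ negXₚ g)
      ∎
    where open ≈ₚ-Reasoning

  sqXₚ : List Carrier → List Carrier
  sqXₚ []      = []
  sqXₚ (a ∷ f) = a ∷ 0# ∷ sqXₚ f

  sqXₚ-[] : ∀ {f} → f ≈ₚ [] → sqXₚ f ≈ₚ []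
  sqXₚ-[] {[]}    _      = ≈ₚ-refl
  sqXₚ-[] {a ∷ f} a∷f≈[] = ∷≈[] a≈0 (∷≈[] refl (sqXₚ-[] f≈[]))
    where open Σ (∷≈[]⁻¹ a∷f≈[]) renaming (proj₁ to a≈0; proj₂ to f≈[])

  sqXₚ-cong : ∀ {f g} → f ≈ₚ g → sqXₚ f ≈ₚ sqXₚ g
  sqXₚ-cong {[]}    {g}     []≈g = ≈ₚ-sym (sqXₚ-[] (≈ₚ-sym []≈g))
  sqXₚ-cong {a ∷ f} {[]}    f≈[] = sqXₚ-[] f≈[]
  sqXₚ-cong {a ∷ f} {b ∷ g} e    = ∷-cong a≈b (∷-cong refl (sqXₚ-cong f≈g))
    where open Σ (∷-injective e) renaming (proj₁ to a≈b; proj₂ to f≈g)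

  sqXₚ-+ₚ : ∀ f g → sqXₚ (f +ₚ g) ≈ₚ sqXₚ f +ₚ sqXₚ g
  sqXₚ-+ₚ []      g       = ≈ₚ-refl
  sqXₚ-+ₚ (a ∷ f) []      = ≈ₚ-refl
  sqXₚ-+ₚ (a ∷ f) (b ∷ g) = ∷-cong refl (∷-cong (sym (+-identityˡ 0#)) (sqXₚ-+ₚ f g))

  sqXₚ-scale : ∀ a f → sqXₚ (scale a f) ≈ₚ scale a (sqXₚ f)
  sqXₚ-scale a []      = ≈ₚ-refl
  sqXₚ-scale a (b ∷ f) = ∷-cong refl (∷-cong (sym (zeroʳ a)) (sqXₚ-scale a f))

  sqXₚ-*ₚ : ∀ f g → sqXₚ (f *ₚ g) ≈ₚ sqXₚ f *ₚ sqXₚ g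
  sqXₚ-*ₚ []      g = ≈ₚ-refl
  sqXₚ-*ₚ (a ∷ f) g = begin
    sqXₚ (scale a g +ₚ (0# ∷ f *ₚ g))
      ≈⟨ sqXₚ-+ₚ (scale a g) (0# ∷ f *ₚ g) ⟩
    sqXₚ (scale a g) +ₚ (0# ∷ 0# ∷ sqXₚ (f *ₚ g))
      ≈⟨ +ₚ-cong (sqXₚ-scale a g) (∷-cong refl (∷-cong refl (sqXₚ-*ₚ f g))) ⟩
    scale a (sqXₚ g) +ₚ (0# ∷ 0# ∷ sqXₚ f *ₚ sqXₚ g)
      ≈⟨ +ₚ-cong ≈ₚ-refl (∷-cong refl (0∷-*ₚ (sqXₚ f) (sqXₚ g))) ⟨
    scale a (sqXₚ g) +ₚ (0# ∷ (0# ∷ sqXₚ f) *ₚ sqXₚ g)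
      ∎
    where open ≈ₚ-Reasoning

  sqXₚ-1ₚ : sqXₚ 1ₚ ≈ₚ 1ₚ
  sqXₚ-1ₚ = ∷-cong refl (∷≈[] refl ≈ₚ-refl)

  module _ {φ : Carrier → Carrier} (φ-isRingHomomorphism : IsRingHomomorphism rawRing rawRing φ) where

    open IsRingHomomorphism φ-isRingHomomorphism using (+-homo; *-homo; 0#-homo; 1#-homo)

    map-+ₚ : ∀ f g → map φ (f +ₚ g) ≈ₚ map φ f +ₚ map φ g
    map-+ₚ []      g       = ≈ₚ-refl
    map-+ₚ (a ∷ f) []      = ≈ₚ-refl
    map-+ₚ (a ∷ f) (b ∷ g) = ∷-cong (+-homo a b) (map-+ₚ f g)

    map-scale : ∀ a f → map φ (scale a f) ≈ₚ scale (φ a) (map φ f)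
    map-scale a []      = ≈ₚ-refl
    map-scale a (b ∷ f) = ∷-cong (*-homo a b) (map-scale a f)

    map-*ₚ : ∀ f g → map φ (f *ₚ g) ≈ₚ map φ f *ₚ map φ g
    map-*ₚ []      g = ≈ₚ-refl
    map-*ₚ (a ∷ f) g = begin
      map φ (scale a g +ₚ (0# ∷ f *ₚ g))               ≈⟨ map-+ₚ (scale a g) (0# ∷ f *ₚ g) ⟩
      map φ (scale a g) +ₚ (φ 0# ∷ map φ (f *ₚ g))      ≈⟨ +ₚ-cong (map-scale a g) (∷-cong 0#-homo (map-*ₚ f g)) ⟩
      scale (φ a) (map φ g) +ₚ (0# ∷ map φ f *ₚ map φ g) ∎
      where open ≈ₚ-Reasoning

    map-1ₚ : map φ 1ₚ ≈ₚ 1ₚ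
    map-1ₚ = ∷-cong 1#-homo ≈ₚ-refl

  ∏ₚ : List (List Carrier) → List Carrier
  ∏ₚ = foldr _*ₚ_ 1ₚ

  ∏ₚ-↭ : ∀ {fs gs} → fs ↭ gs → ∏ₚ fs ≈ₚ ∏ₚ gs
  ∏ₚ-↭ fs↭gs = foldr-commMonoid *ₚ-isCommutativeMonoid (↭⇒↭ₛ′ ≈ₚ-isEquivalence fs↭gs)

  ∏ₚ-homo : ∀ (φ : List Carrier → List Carrier) → (∀ f g → φ (f *ₚ g) ≈ₚ φ f *ₚ φ g) → φ 1ₚ ≈ₚ 1ₚ →
            ∀ fs → φ (∏ₚ fs) ≈ₚ ∏ₚ (map φ fs)
  ∏ₚ-homo φ φ-*ₚ φ-1ₚ []       = φ-1ₚ
  ∏ₚ-homo φ φ-*ₚ φ-1ₚ (f ∷ fs) = ≈ₚ-trans (φ-*ₚ f (∏ₚ fs)) (*ₚ-congʳ (φ f) (∏ₚ-homo φ φ-*ₚ φ-1ₚ fs))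

  ∏ₚ-map-cong : ∀ {a} {A : Set a} {F H : A → List Carrier} → (∀ x → F x ≈ₚ H x) →
                ∀ xs → ∏ₚ (map F xs) ≈ₚ ∏ₚ (map H xs)
  ∏ₚ-map-cong F≈H []       = ≈ₚ-refl
  ∏ₚ-map-cong F≈H (x ∷ xs) = *ₚ-cong (F≈H x) (∏ₚ-map-cong F≈H xs)

  ∏ₚ-map-*ₚ : ∀ {a} {A : Set a} (F H : A → List Carrier) xs →
              ∏ₚ (map F xs) *ₚ ∏ₚ (map H xs) ≈ₚ ∏ₚ (map (λ x → F x *ₚ H x) xs)
  ∏ₚ-map-*ₚ F H []       = *ₚ-identityˡ 1ₚ
  ∏ₚ-map-*ₚ F H (x ∷ xs) = ≈ₚ-trans (*ₚ-interchange (F x) (∏ₚ (map F xs)) (H x) (∏ₚ (map H xs)))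
                                    (*ₚ-congʳ (F x *ₚ H x) (∏ₚ-map-*ₚ F H xs))

  ∏ₚ-map--ₚ : ∀ k fs → length fs ≡ k ℕ.+ k → ∏ₚ (map -ₚ_ fs) ≈ₚ ∏ₚ fs
  ∏ₚ-map--ₚ zero    []           _   = ≈ₚ-refl
  ∏ₚ-map--ₚ (suc k) (f ∷ [])     len =
    contradiction (suc-injective len) (λ 0≡k+1+k → 0≢1+n (≡-trans 0≡k+1+k (+-suc k k)))
  ∏ₚ-map--ₚ (suc k) (f ∷ g ∷ fs) len = begin
    -ₚ f *ₚ (-ₚ g *ₚ ∏ₚ (map -ₚ_ fs))   ≈⟨ *ₚ-assoc (-ₚ f) (-ₚ g) _ ⟨
    -ₚ f *ₚ -ₚ g *ₚ ∏ₚ (map -ₚ_ fs)     ≈⟨ *ₚ-cong (-ₚ-*ₚ--ₚ f g) (∏ₚ-map--ₚ k fs len′) ⟩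
    f *ₚ g *ₚ ∏ₚ fs                    ≈⟨ *ₚ-assoc f g (∏ₚ fs) ⟩
    f *ₚ (g *ₚ ∏ₚ fs)                  ∎
    where
    open ≈ₚ-Reasoning
    len′ : length fs ≡ k ℕ.+ k
    len′ = suc-injective (suc-injective (≡-trans len (cong suc (+-suc k k))))

  linearₚ : Carrier → List Carrier
  linearₚ z = - z ∷ 1# ∷ []

  linearₚ-*ₚ-negXₚ : ∀ z → linearₚ z *ₚ negXₚ (linearₚ z) ≈ₚ -ₚ sqXₚ (linearₚ (z * z))
  -- The sides unfold to [−z·−z + 0, −z·−1 + (1·−z + 0), 1·−1] and [−−(z·z), −0, −1, −0].
  linearₚ-*ₚ-negXₚ z =
    ∷-cong constant (∷-cong linear (∷-cong (*-identityˡ (- 1#)) (≈ₚ-sym (∷≈[] -0#≈0# ≈ₚ-refl))))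
    where
    open SetoidReasoning setoid
    constant : - z * - z + 0# ≈ - - (z * z)
    constant = trans (+-identityʳ (- z * - z)) (trans (-x*-y≈x*y z z) (sym (-‿involutive (z * z))))
    linear : - z * - 1# + (1# * - z + 0#) ≈ - 0#
    linear = begin
      - z * - 1# + (1# * - z + 0#)
        ≈⟨ +-cong (trans (-x*-y≈x*y z 1#) (*-identityʳ z)) (trans (+-identityʳ (1# * - z)) (*-identityˡ (- z))) ⟩
      z + - z
        ≈⟨ -‿inverseʳ z ⟩
      0#
        ≈⟨ -0#≈0# ⟨
      - 0#
        ∎

open ≡ using (refl; sym; trans; cong; cong₂; subst)

module Congruence (n : ℕ) .{{_ : NonZero n}} where

  open import Data.Nat using (_+_; _*_; _^_; _∸_; _<_; >-nonZero⁻¹)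
  open import Data.Nat.Properties using (+-identityʳ; +-assoc; +-comm; +-suc; *-assoc; m+[n∸m]≡n; <⇒≢)
  open import Data.Nat.Tactic.RingSolver using (solve-∀)

  infix 4 _≡ₘ_
  _≡ₘ_ : ℕ → ℕ → Set
  a ≡ₘ b = a % n ≡ b % n

  ≡ₘ-setoid : Setoid 0ℓ 0ℓ
  ≡ₘ-setoid = On.setoid (≡.setoid ℕ) (_% n)

  module ≡ₘ-Reasoning = SetoidReasoning ≡ₘ-setoid

  ≡⇒≡ₘ : ∀ {a b} → a ≡ b → a ≡ₘ b
  ≡⇒≡ₘ = cong (_% n)

  0%n≡0 : 0 % n ≡ 0
  0%n≡0 = m*n%n≡0 0 n

  ≡ₘ⇒≡ : ∀ {a b} → a < n → b < n → a ≡ₘ b → a ≡ b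
  ≡ₘ⇒≡ a<n b<n a≡b = trans (sym (m<n⇒m%n≡m a<n)) (trans a≡b (m<n⇒m%n≡m b<n))

  <n⇒≢ₘ0 : ∀ {x} → 0 < x → x < n → ¬ x ≡ₘ 0
  <n⇒≢ₘ0 {x} 0<x x<n x≡0 = <⇒≢ 0<x (sym (trans (sym (m<n⇒m%n≡m x<n)) (trans x≡0 0%n≡0)))

  %-≡ₘ : ∀ a → a % n ≡ₘ a
  %-≡ₘ a = m%n%n≡m%n a n

  n≡ₘ0 : n ≡ₘ 0
  n≡ₘ0 = trans (n%n≡0 n) (sym 0%n≡0)

  +-congₘ : ∀ {a a′ b b′} → a ≡ₘ a′ → b ≡ₘ b′ → a + b ≡ₘ a′ + b′
  +-congₘ {a} {a′} {b} {b′} a≡a′ b≡b′ = begin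
    (a + b) % n            ≡⟨ %-distribˡ-+ a b n ⟩
    (a % n + b % n) % n    ≡⟨ cong₂ (λ x y → (x + y) % n) a≡a′ b≡b′ ⟩
    (a′ % n + b′ % n) % n  ≡⟨ %-distribˡ-+ a′ b′ n ⟨
    (a′ + b′) % n          ∎
    where open ≡.≡-Reasoning

  *-congₘ : ∀ {a a′ b b′} → a ≡ₘ a′ → b ≡ₘ b′ → a * b ≡ₘ a′ * b′
  *-congₘ {a} {a′} {b} {b′} a≡a′ b≡b′ = begin
    (a * b) % n                ≡⟨ %-distribˡ-* a b n ⟩
    ((a % n) * (b % n)) % n    ≡⟨ cong₂ (λ x y → (x * y) % n) a≡a′ b≡b′ ⟩
    ((a′ % n) * (b′ % n)) % n  ≡⟨ %-distribˡ-* a′ b′ n ⟨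
    (a′ * b′) % n              ∎
    where open ≡.≡-Reasoning

  negateₘ : ℕ → ℕ
  negateₘ a = n ∸ a % n

  +-inverseₘ : ∀ a → a + negateₘ a ≡ₘ 0
  +-inverseₘ a = begin
    a + (n ∸ a % n)      ≈⟨ +-congₘ (sym (%-≡ₘ a)) refl ⟩
    a % n + (n ∸ a % n)  ≡⟨ m+[n∸m]≡n (m%n≤n a n) ⟩
    n                    ≈⟨ n≡ₘ0 ⟩
    0                    ∎
    where open ≡ₘ-Reasoning

  negateₘ-≢ₘ0 : ∀ {a} → ¬ a ≡ₘ 0 → ¬ negateₘ a ≡ₘ 0
  negateₘ-≢ₘ0 {a} a≢0 -a≡0 = a≢0 (begin
    a                ≡⟨ +-identityʳ a ⟨
    a + 0            ≈⟨ +-congₘ {a} refl (sym -a≡0) ⟩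
    a + negateₘ a    ≈⟨ +-inverseₘ a ⟩
    0                ∎)
    where open ≡ₘ-Reasoning

  +-cancelʳ-≡ₘ : ∀ {a b} c → a + c ≡ₘ b + c → a ≡ₘ b
  +-cancelʳ-≡ₘ {a} {b} c a+c≡b+c = begin
    a                          ≡⟨ +-identityʳ a ⟨
    a + 0                      ≈⟨ +-congₘ {a} refl (sym (+-inverseₘ c)) ⟩
    a + (c + negateₘ c)        ≡⟨ +-assoc a c (negateₘ c) ⟨
    a + c + negateₘ c          ≈⟨ +-congₘ a+c≡b+c refl ⟩
    b + c + negateₘ c          ≡⟨ +-assoc b c (negateₘ c) ⟩
    b + (c + negateₘ c)        ≈⟨ +-congₘ {b} refl (+-inverseₘ c) ⟩
    b + 0                      ≡⟨ +-identityʳ b ⟩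
    b                          ∎
    where open ≡ₘ-Reasoning

  +-cancelˡ-≡ₘ : ∀ c {a b} → c + a ≡ₘ c + b → a ≡ₘ b
  +-cancelˡ-≡ₘ c {a} {b} c+a≡c+b =
    +-cancelʳ-≡ₘ c (trans (≡⇒≡ₘ (+-comm a c)) (trans c+a≡c+b (≡⇒≡ₘ (+-comm c b))))

  -1ₘ : ℕ
  -1ₘ = n ∸ 1

  1+-1ₘ≡n : 1 + -1ₘ ≡ n
  1+-1ₘ≡n = m+[n∸m]≡n (>-nonZero⁻¹ n)

  -1ₘ*a+a≡ₘ0 : ∀ a → -1ₘ * a + a ≡ₘ 0
  -1ₘ*a+a≡ₘ0 a = begin
    -1ₘ * a + a      ≡⟨ +-comm (-1ₘ * a) a ⟩
    (1 + -1ₘ) * a    ≡⟨ cong (_* a) 1+-1ₘ≡n ⟩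
    n * a            ≈⟨ *-congₘ n≡ₘ0 (refl {x = a % n}) ⟩
    0                ∎
    where open ≡ₘ-Reasoning

  -1ₘ*-1ₘ≡ₘ1 : -1ₘ * -1ₘ ≡ₘ 1
  -1ₘ*-1ₘ≡ₘ1 = +-cancelʳ-≡ₘ -1ₘ (trans (-1ₘ*a+a≡ₘ0 -1ₘ) (sym (trans (≡⇒≡ₘ 1+-1ₘ≡n) n≡ₘ0)))

  -1ₘ^[m+m]≡ₘ1 : ∀ m → -1ₘ ^ (m + m) ≡ₘ 1
  -1ₘ^[m+m]≡ₘ1 zero    = refl
  -1ₘ^[m+m]≡ₘ1 (suc m) = begin
    -1ₘ * -1ₘ ^ (m + suc m)        ≡⟨ cong (λ k → -1ₘ * -1ₘ ^ k) (+-suc m m) ⟩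
    -1ₘ * (-1ₘ * -1ₘ ^ (m + m))    ≡⟨ *-assoc -1ₘ -1ₘ (-1ₘ ^ (m + m)) ⟨
    -1ₘ * -1ₘ * -1ₘ ^ (m + m)      ≈⟨ *-congₘ -1ₘ*-1ₘ≡ₘ1 (-1ₘ^[m+m]≡ₘ1 m) ⟩
    1                              ∎
    where open ≡ₘ-Reasoning

  negateₘ≡ₘ-1ₘ* : ∀ a → negateₘ a ≡ₘ -1ₘ * a
  negateₘ≡ₘ-1ₘ* a = +-cancelʳ-≡ₘ a (trans (≡⇒≡ₘ (+-comm (negateₘ a) a)) (trans (+-inverseₘ a) (sym (-1ₘ*a+a≡ₘ0 a))))

  doubleₘ : ℕ → ℕ
  doubleₘ a = (a + a) % n

  doubleₘ≡ₘ2* : ∀ a → doubleₘ a ≡ₘ 2 * a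
  doubleₘ≡ₘ2* a = trans (%-≡ₘ (a + a)) (≡⇒≡ₘ (cong (a +_) (sym (+-identityʳ a))))

  Square : ℕ → Set
  Square a = Σ ℕ λ x → x * x ≡ₘ a

  Square-resp : ∀ {a b} → a ≡ₘ b → Square a → Square b
  Square-resp a≡b (x , xx≡a) = x , trans xx≡a a≡b

  Square-* : ∀ {a b} → Square a → Square b → Square (a * b)
  Square-* (x , xx≡a) (y , yy≡b) = x * y , trans (≡⇒≡ₘ (interchange x y)) (*-congₘ xx≡a yy≡b)
    where
    interchange : ∀ x y → x * y * (x * y) ≡ x * x * (y * y)
    interchange = solve-∀

  ¬Square⇒≢ₘ0 : ∀ {a} → ¬ Square a → ¬ a ≡ₘ 0
  ¬Square⇒≢ₘ0 nonsquare a≡0 = nonsquare (0 , sym a≡0)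

module ZMod (n : ℕ) .{{_ : NonZero n}} where

  open Congruence n
  open import Data.Nat using (_+_; _∸_)
  open import Data.Nat.Properties using (+-identityʳ; +-assoc; +-comm; m∸n+n≡m; ≤-trans; <⇒≤; m≤n+m; +-commutativeSemigroup)
  open import Algebra.Properties.CommutativeSemigroup +-commutativeSemigroup using (interchange)

  infixl 6 _⊕_ _⊝_
  _⊕_ : Fin n → Fin n → Fin n
  i ⊕ j = (toℕ i + toℕ j) mod n

  _⊝_ : Fin n → Fin n → Fin n
  k ⊝ i = (toℕ k + n ∸ toℕ i) mod n

  ⊖_ : Fin n → Fin n
  ⊖ k = (n ∸ toℕ k) mod n

  toℕ-mod : ∀ a → toℕ (a mod n) ≡ₘ a
  toℕ-mod a = trans (cong (_% n) (toℕ-fromℕ< _)) (%-≡ₘ a)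

  toℕ-injectiveₘ : ∀ {i j : Fin n} → toℕ i ≡ₘ toℕ j → i ≡ j
  toℕ-injectiveₘ {i} {j} i≡j = toℕ-injective (≡ₘ⇒≡ (toℕ<n i) (toℕ<n j) i≡j)

  toℕ-⊕ : ∀ i j → toℕ (i ⊕ j) ≡ₘ toℕ i + toℕ j
  toℕ-⊕ i j = toℕ-mod (toℕ i + toℕ j)

  toℕ-⊝ : ∀ k i → toℕ (k ⊝ i) + toℕ i ≡ₘ toℕ k
  toℕ-⊝ k i = begin
    toℕ (k ⊝ i) + toℕ i         ≈⟨ +-congₘ (toℕ-mod (toℕ k + n ∸ toℕ i)) refl ⟩
    (toℕ k + n ∸ toℕ i) + toℕ i  ≡⟨ m∸n+n≡m (≤-trans (<⇒≤ (toℕ<n i)) (m≤n+m n (toℕ k))) ⟩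
    toℕ k + n                   ≈⟨ +-congₘ {toℕ k} refl n≡ₘ0 ⟩
    toℕ k + 0                   ≡⟨ +-identityʳ (toℕ k) ⟩
    toℕ k                       ∎
    where open ≡ₘ-Reasoning

  toℕ-⊖ : ∀ k → toℕ (⊖ k) + toℕ k ≡ₘ 0
  toℕ-⊖ k = begin
    toℕ (⊖ k) + toℕ k      ≈⟨ +-congₘ (toℕ-mod (n ∸ toℕ k)) refl ⟩
    n ∸ toℕ k + toℕ k      ≡⟨ m∸n+n≡m (<⇒≤ (toℕ<n k)) ⟩
    n                      ≈⟨ n≡ₘ0 ⟩
    0                      ∎
    where open ≡ₘ-Reasoning

  ⊝-unique : ∀ {k i j} → toℕ j + toℕ i ≡ₘ toℕ k → k ⊝ i ≡ j
  ⊝-unique {k} {i} j+i≡k = toℕ-injectiveₘ (+-cancelʳ-≡ₘ (toℕ i) (trans (toℕ-⊝ k i) (sym j+i≡k)))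

  ⊖-unique : ∀ {k j} → toℕ j + toℕ k ≡ₘ 0 → ⊖ k ≡ j
  ⊖-unique {k} j+k≡0 = toℕ-injectiveₘ (+-cancelʳ-≡ₘ (toℕ k) (trans (toℕ-⊖ k) (sym j+k≡0)))

  ⊕-comm : ∀ i j → i ⊕ j ≡ j ⊕ i
  ⊕-comm i j = cong (_mod n) (+-comm (toℕ i) (toℕ j))

  ⊝-involutive : ∀ k i → k ⊝ (k ⊝ i) ≡ i
  ⊝-involutive k i = ⊝-unique (trans (≡⇒≡ₘ (+-comm (toℕ i) (toℕ (k ⊝ i)))) (toℕ-⊝ k i))

  [i⊕j]⊝i≡j : ∀ i j → (i ⊕ j) ⊝ i ≡ j
  [i⊕j]⊝i≡j i j = ⊝-unique (trans (≡⇒≡ₘ (+-comm (toℕ j) (toℕ i))) (sym (toℕ-⊕ i j)))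

  k⊝0≡k : ∀ k → k ⊝ (0 mod n) ≡ k
  k⊝0≡k k = ⊝-unique (trans (+-congₘ {toℕ k} refl (toℕ-mod 0)) (≡⇒≡ₘ (+-identityʳ (toℕ k))))

  ⊖-mod : ∀ a → ⊖ (a mod n) ≡ negateₘ a mod n
  ⊖-mod a = cong (λ t → (n ∸ t) mod n) (toℕ-fromℕ< (m%n<n a n))

  ⊕-mod : ∀ a → (a mod n) ⊕ (a mod n) ≡ doubleₘ a mod n
  ⊕-mod a = toℕ-injectiveₘ (begin
    toℕ ((a mod n) ⊕ (a mod n))           ≈⟨ toℕ-⊕ (a mod n) (a mod n) ⟩
    toℕ (a mod n) + toℕ (a mod n)         ≈⟨ +-congₘ (toℕ-mod a) (toℕ-mod a) ⟩
    a + a                                 ≈⟨ sym (%-≡ₘ (a + a)) ⟩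
    doubleₘ a                             ≈⟨ sym (toℕ-mod (doubleₘ a)) ⟩
    toℕ (doubleₘ a mod n)                 ∎)
    where open ≡ₘ-Reasoning

  ⊖0≡0 : ⊖ (0 mod n) ≡ 0 mod n
  ⊖0≡0 = ⊖-unique (+-congₘ (toℕ-mod 0) (toℕ-mod 0))

  [j⊕i]⊝i≡j : ∀ j i → (j ⊕ i) ⊝ i ≡ j
  [j⊕i]⊝i≡j j i = trans (cong (_⊝ i) (⊕-comm j i)) ([i⊕j]⊝i≡j i j)

  [k⊝i]⊕i≡k : ∀ k i → (k ⊝ i) ⊕ i ≡ k
  [k⊝i]⊕i≡k k i = toℕ-injectiveₘ (trans (toℕ-⊕ (k ⊝ i) i) (toℕ-⊝ k i))

  k⊝[j⊕i]≡[k⊝i]⊝j : ∀ k j i → k ⊝ (j ⊕ i) ≡ (k ⊝ i) ⊝ j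
  k⊝[j⊕i]≡[k⊝i]⊝j k j i = ⊝-unique (begin
    toℕ ((k ⊝ i) ⊝ j) + toℕ (j ⊕ i)            ≈⟨ +-congₘ {toℕ ((k ⊝ i) ⊝ j)} refl (toℕ-⊕ j i) ⟩
    toℕ ((k ⊝ i) ⊝ j) + (toℕ j + toℕ i)        ≡⟨ +-assoc (toℕ ((k ⊝ i) ⊝ j)) (toℕ j) (toℕ i) ⟨
    toℕ ((k ⊝ i) ⊝ j) + toℕ j + toℕ i          ≈⟨ +-congₘ (toℕ-⊝ (k ⊝ i) j) refl ⟩
    toℕ (k ⊝ i) + toℕ i                        ≈⟨ toℕ-⊝ k i ⟩
    toℕ k                                      ∎)
    where open ≡ₘ-Reasoning

  ⊖-involutive : ∀ k → ⊖ (⊖ k) ≡ k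
  ⊖-involutive k = ⊖-unique (trans (≡⇒≡ₘ (+-comm (toℕ k) (toℕ (⊖ k)))) (toℕ-⊖ k))

  ⊖[k⊝⊖i]≡⊖k⊝i : ∀ k i → ⊖ (k ⊝ ⊖ i) ≡ ⊖ k ⊝ i
  ⊖[k⊝⊖i]≡⊖k⊝i k i = ⊖-unique (+-cancelʳ-≡ₘ (toℕ i + toℕ (⊖ i)) (begin
    toℕ (⊖ k ⊝ i) + toℕ (k ⊝ ⊖ i) + (toℕ i + toℕ (⊖ i))
      ≡⟨ interchange (toℕ (⊖ k ⊝ i)) (toℕ (k ⊝ ⊖ i)) (toℕ i) (toℕ (⊖ i)) ⟩
    (toℕ (⊖ k ⊝ i) + toℕ i) + (toℕ (k ⊝ ⊖ i) + toℕ (⊖ i))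
      ≈⟨ +-congₘ (toℕ-⊝ (⊖ k) i) (toℕ-⊝ k (⊖ i)) ⟩
    toℕ (⊖ k) + toℕ k
      ≈⟨ toℕ-⊖ k ⟩
    0
      ≈⟨ sym (trans (≡⇒≡ₘ (+-comm (toℕ i) (toℕ (⊖ i)))) (toℕ-⊖ i)) ⟩
    toℕ i + toℕ (⊖ i)
      ∎))
    where open ≡ₘ-Reasoning

module GroupRing (n : ℕ) .{{_ : NonZero n}} where

  open ZMod n
  open import Algebra.Properties.Monoid.Sum ℤₚ.+-0-monoid using (sum; sum-cong-≗; sum-replicate-zero)
  open import Algebra.Properties.CommutativeMonoid.Sum ℤₚ.+-0-commutativeMonoid
    using (∑-comm; sum-permute; ∑-distrib-+; sum-remove)
  open import Algebra.Properties.Semiring.Sum ℤₚ.+-*-semiring using (*-distribˡ-sum; *-distribʳ-sum)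
  open import Data.Fin.Permutation using (permutation)
  open import Data.Fin.Properties using (punchInᵢ≢i)
  open import Data.Vec.Functional using (removeAt)
  open import Data.Nat using (_≡ᵇ_)
  open import Data.Nat.Properties using (≡ᵇ⇒≡; ≡⇒≡ᵇ)
  import Algebra.Construct.Pointwise (Fin n) as Pointwise

  infixl 7 _∙_
  _∙_ : Cyc n → Cyc n → Cyc n
  _∙_ = _*C_ n

  sumFin≡sum : ∀ {m} (f : Fin m → ℤ) → sumFin f ≡ sum f
  sumFin≡sum {zero}  f = refl
  sumFin≡sum {suc m} f = cong₂ ℤ._+_ (refl {x = f Fin.zero}) (sumFin≡sum (f ∘ Fin.suc))

  ∙-sum : ∀ a b k → (a ∙ b) k ≡ sum (λ i → a i ℤ.* b (k ⊝ i))
  ∙-sum a b k = sumFin≡sum (λ i → a i ℤ.* b (k ⊝ i))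

  sum-reindex : ∀ (f : Fin n → ℤ) (σ τ : Fin n → Fin n) →
                (∀ i → σ (τ i) ≡ i) → (∀ i → τ (σ i) ≡ i) → sum f ≡ sum (λ i → f (σ i))
  sum-reindex f σ τ στ τσ = sum-permute f (permutation _ _ στ τσ)

  sum-δ : ∀ {m} (f : Fin m → ℤ) j → (∀ i → i ≢ j → f i ≡ 0ℤ) → sum f ≡ f j
  sum-δ {suc m} f j f≡0 = begin
    sum f                       ≡⟨ sum-remove {i = j} f ⟩
    f j ℤ.+ sum (removeAt f j)  ≡⟨ cong₂ ℤ._+_ (refl {x = f j}) removed≡0 ⟩
    f j ℤ.+ 0ℤ                  ≡⟨ ℤₚ.+-identityʳ (f j) ⟩
    f j                         ∎
    where
    open ≡.≡-Reasoning
    removed≡0 : sum (removeAt f j) ≡ 0ℤ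
    removed≡0 = trans (sum-cong-≗ (λ i → f≡0 _ (punchInᵢ≢i j i))) (sum-replicate-zero m)

  ∙-cong : ∀ {a a′ b b′} → a ≗ a′ → b ≗ b′ → a ∙ b ≗ a′ ∙ b′
  ∙-cong {a} {a′} {b} {b′} a≗a′ b≗b′ k = begin
    (a ∙ b) k                        ≡⟨ ∙-sum a b k ⟩
    sum (λ i → a i ℤ.* b (k ⊝ i))    ≡⟨ sum-cong-≗ (λ i → cong₂ ℤ._*_ (a≗a′ i) (b≗b′ (k ⊝ i))) ⟩
    sum (λ i → a′ i ℤ.* b′ (k ⊝ i))  ≡⟨ ∙-sum a′ b′ k ⟨
    (a′ ∙ b′) k                      ∎
    where open ≡.≡-Reasoning

  ∙-comm : ∀ a b → a ∙ b ≗ b ∙ a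
  ∙-comm a b k = begin
    (a ∙ b) k                                  ≡⟨ ∙-sum a b k ⟩
    sum (λ i → a i ℤ.* b (k ⊝ i))              ≡⟨ sum-reindex _ (k ⊝_) (k ⊝_) (⊝-involutive k) (⊝-involutive k) ⟩
    sum (λ i → a (k ⊝ i) ℤ.* b (k ⊝ (k ⊝ i)))  ≡⟨ sum-cong-≗ swap ⟩
    sum (λ i → b i ℤ.* a (k ⊝ i))              ≡⟨ ∙-sum b a k ⟨
    (b ∙ a) k                                  ∎
    where
    open ≡.≡-Reasoning
    swap : ∀ i → a (k ⊝ i) ℤ.* b (k ⊝ (k ⊝ i)) ≡ b i ℤ.* a (k ⊝ i)
    swap i = trans (cong (λ j → a (k ⊝ i) ℤ.* b j) (⊝-involutive k i)) (ℤₚ.*-comm (a (k ⊝ i)) (b i))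

  ∙-assoc : ∀ a b c → (a ∙ b) ∙ c ≗ a ∙ (b ∙ c)
  ∙-assoc a b c k = begin
    ((a ∙ b) ∙ c) k
      ≡⟨ ∙-sum (a ∙ b) c k ⟩
    sum (λ j → (a ∙ b) j ℤ.* c (k ⊝ j))
      ≡⟨ sum-cong-≗ (λ j → cong (ℤ._* c (k ⊝ j)) (∙-sum a b j)) ⟩
    sum (λ j → sum (λ i → a i ℤ.* b (j ⊝ i)) ℤ.* c (k ⊝ j))
      ≡⟨ sum-cong-≗ (λ j → *-distribʳ-sum (c (k ⊝ j)) (λ i → a i ℤ.* b (j ⊝ i))) ⟩
    sum (λ j → sum (λ i → a i ℤ.* b (j ⊝ i) ℤ.* c (k ⊝ j)))
      ≡⟨ ∑-comm (λ j i → a i ℤ.* b (j ⊝ i) ℤ.* c (k ⊝ j)) ⟩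
    sum (λ i → sum (λ j → a i ℤ.* b (j ⊝ i) ℤ.* c (k ⊝ j)))
      ≡⟨ sum-cong-≗ (λ i → sum-cong-≗ (λ j → ℤₚ.*-assoc (a i) (b (j ⊝ i)) (c (k ⊝ j)))) ⟩
    sum (λ i → sum (λ j → a i ℤ.* (b (j ⊝ i) ℤ.* c (k ⊝ j))))
      ≡⟨ sum-cong-≗ (λ i → *-distribˡ-sum (a i) (λ j → b (j ⊝ i) ℤ.* c (k ⊝ j))) ⟨
    sum (λ i → a i ℤ.* sum (λ j → b (j ⊝ i) ℤ.* c (k ⊝ j)))
      ≡⟨ sum-cong-≗ (λ i → cong (a i ℤ.*_) (shift i)) ⟩
    sum (λ i → a i ℤ.* (b ∙ c) (k ⊝ i))
      ≡⟨ ∙-sum a (b ∙ c) k ⟨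
    (a ∙ (b ∙ c)) k
      ∎
    where
    open ≡.≡-Reasoning
    shift : ∀ i → sum (λ j → b (j ⊝ i) ℤ.* c (k ⊝ j)) ≡ (b ∙ c) (k ⊝ i)
    shift i = begin
      sum (λ j → b (j ⊝ i) ℤ.* c (k ⊝ j))
        ≡⟨ sum-reindex _ (_⊕ i) (_⊝ i) (λ j → [k⊝i]⊕i≡k j i) (λ l → [j⊕i]⊝i≡j l i) ⟩
      sum (λ l → b ((l ⊕ i) ⊝ i) ℤ.* c (k ⊝ (l ⊕ i)))
        ≡⟨ sum-cong-≗ (λ l → cong₂ (λ x y → b x ℤ.* c y) ([j⊕i]⊝i≡j l i) (k⊝[j⊕i]≡[k⊝i]⊝j k l i)) ⟩
      sum (λ l → b l ℤ.* c ((k ⊝ i) ⊝ l))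
        ≡⟨ ∙-sum b c (k ⊝ i) ⟨
      (b ∙ c) (k ⊝ i)
        ∎

  ∙-distribʳ : ∀ c a b → (_+C_ n a b) ∙ c ≗ _+C_ n (a ∙ c) (b ∙ c)
  ∙-distribʳ c a b k = begin
    ((_+C_ n a b) ∙ c) k
      ≡⟨ ∙-sum (_+C_ n a b) c k ⟩
    sum (λ i → (a i ℤ.+ b i) ℤ.* c (k ⊝ i))
      ≡⟨ sum-cong-≗ (λ i → ℤₚ.*-distribʳ-+ (c (k ⊝ i)) (a i) (b i)) ⟩
    sum (λ i → a i ℤ.* c (k ⊝ i) ℤ.+ b i ℤ.* c (k ⊝ i))
      ≡⟨ ∑-distrib-+ (λ i → a i ℤ.* c (k ⊝ i)) (λ i → b i ℤ.* c (k ⊝ i)) ⟩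
    sum (λ i → a i ℤ.* c (k ⊝ i)) ℤ.+ sum (λ i → b i ℤ.* c (k ⊝ i))
      ≡⟨ cong₂ ℤ._+_ (∙-sum a c k) (∙-sum b c k) ⟨
    (a ∙ c) k ℤ.+ (b ∙ c) k
      ∎
    where open ≡.≡-Reasoning

  -- ζ^ n r is δ (r mod n) by definition.
  δ : Fin n → Cyc n
  δ j k = if toℕ k ≡ᵇ toℕ j then 1ℤ else 0ℤ

  δ-diag : ∀ j → δ j j ≡ 1ℤ
  δ-diag j with toℕ j ≡ᵇ toℕ j in eq
  ... | true  = refl
  ... | false = ⊥-elim (subst T eq (≡⇒≡ᵇ (toℕ j) (toℕ j) refl))

  δ-off : ∀ {j k} → k ≢ j → δ j k ≡ 0ℤ
  δ-off {j} {k} k≢j with toℕ k ≡ᵇ toℕ j in eq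
  ... | false = refl
  ... | true  = ⊥-elim (k≢j (toℕ-injective (≡ᵇ⇒≡ (toℕ k) (toℕ j) (subst T (sym eq) tt))))

  δ-∙ : ∀ j a k → (δ j ∙ a) k ≡ a (k ⊝ j)
  δ-∙ j a k = begin
    (δ j ∙ a) k                        ≡⟨ ∙-sum (δ j) a k ⟩
    sum (λ i → δ j i ℤ.* a (k ⊝ i))    ≡⟨ sum-δ _ j (λ i i≢j → trans (cong (ℤ._* a (k ⊝ i)) (δ-off i≢j)) (ℤₚ.*-zeroˡ (a (k ⊝ i)))) ⟩
    δ j j ℤ.* a (k ⊝ j)                ≡⟨ cong (ℤ._* a (k ⊝ j)) (δ-diag j) ⟩
    1ℤ ℤ.* a (k ⊝ j)                   ≡⟨ ℤₚ.*-identityˡ (a (k ⊝ j)) ⟩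
    a (k ⊝ j)                          ∎
    where open ≡.≡-Reasoning

  ∙-identityˡ : ∀ a → 1C n ∙ a ≗ a
  ∙-identityˡ a k = trans (δ-∙ (0 mod n) a k) (cong a (k⊝0≡k k))

  δ-∙-δ : ∀ i j → δ i ∙ δ j ≗ δ (i ⊕ j)
  δ-∙-δ i j k with k Fin.≟ i ⊕ j
  ... | yes refl = trans (δ-∙ i (δ j) (i ⊕ j)) (trans (cong (δ j) ([i⊕j]⊝i≡j i j)) (trans (δ-diag j) (sym (δ-diag (i ⊕ j)))))
  ... | no k≢i⊕j = trans (δ-∙ i (δ j) k) (trans (δ-off k⊝i≢j) (sym (δ-off k≢i⊕j)))
    where
    k⊝i≢j : k ⊝ i ≢ j
    k⊝i≢j k⊝i≡j = k≢i⊕j (trans (sym ([k⊝i]⊕i≡k k i)) (trans (cong (_⊕ i) k⊝i≡j) (⊕-comm j i)))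

  conj-δ : ∀ j → conj n (δ j) ≗ δ (⊖ j)
  conj-δ j k with k Fin.≟ ⊖ j
  ... | yes refl = trans (cong (δ j) (⊖-involutive j)) (trans (δ-diag j) (sym (δ-diag (⊖ j))))
  ... | no k≢⊖j = trans (δ-off ⊖k≢j) (sym (δ-off k≢⊖j))
    where
    ⊖k≢j : ⊖ k ≢ j
    ⊖k≢j ⊖k≡j = k≢⊖j (trans (sym (⊖-involutive k)) (cong ⊖_ ⊖k≡j))

  conj-∙ : ∀ a b → conj n (a ∙ b) ≗ conj n a ∙ conj n b
  conj-∙ a b k = begin
    (a ∙ b) (⊖ k)
      ≡⟨ ∙-sum a b (⊖ k) ⟩
    sum (λ i → a i ℤ.* b (⊖ k ⊝ i))
      ≡⟨ sum-cong-≗ (λ i → cong₂ (λ x y → a x ℤ.* b y) (sym (⊖-involutive i)) (sym (⊖[k⊝⊖i]≡⊖k⊝i k i))) ⟩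
    sum (λ i → a (⊖ ⊖ i) ℤ.* b (⊖ (k ⊝ ⊖ i)))
      ≡⟨ sum-reindex _ ⊖_ ⊖_ ⊖-involutive ⊖-involutive ⟨
    sum (λ i → a (⊖ i) ℤ.* b (⊖ (k ⊝ i)))
      ≡⟨ ∙-sum (conj n a) (conj n b) k ⟨
    (conj n a ∙ conj n b) k
      ∎
    where open ≡.≡-Reasoning

  isCommutativeRing : IsCommutativeRing _≗_ (_+C_ n) _∙_ (-C_ n) (0C n) (1C n)
  isCommutativeRing = record
    { isRing = record
      { +-isAbelianGroup = Pointwise.isAbelianGroup ℤₚ.+-0-isAbelianGroup
      ; *-cong           = ∙-cong
      ; *-assoc          = ∙-assoc
      ; *-identity       = ∙-identityˡ , λ a k → trans (∙-comm a (1C n) k) (∙-identityˡ a k)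
      ; distrib          = ∙-distribˡ , ∙-distribʳ
      }
    ; *-comm = ∙-comm
    }
    where
    ∙-distribˡ : ∀ a b c → a ∙ (_+C_ n b c) ≗ _+C_ n (a ∙ b) (a ∙ c)
    ∙-distribˡ a b c k =
      trans (∙-comm a (_+C_ n b c) k) (trans (∙-distribʳ a b c k) (cong₂ ℤ._+_ (∙-comm b a k) (∙-comm c a k)))

  commutativeRing : CommutativeRing 0ℓ 0ℓ
  commutativeRing = record { isCommutativeRing = isCommutativeRing }

  open RingMorphisms (CommutativeRing.rawRing commutativeRing) (CommutativeRing.rawRing commutativeRing)
    using (IsRingHomomorphism)

  conj-isRingHomomorphism : IsRingHomomorphism (conj n)
  conj-isRingHomomorphism = record
    { isSemiringHomomorphism = record
      { isNearSemiringHomomorphism = record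
        { +-isMonoidHomomorphism = record
          { isMagmaHomomorphism = record
            { isRelHomomorphism = record { cong = λ a≗b k → a≗b (⊖ k) }
            ; homo = λ a b k → refl
            }
          ; ε-homo = λ k → refl
          }
        ; *-homo = conj-∙
        }
      ; 1#-homo = λ k → trans (conj-δ (0 mod n) k) (cong (λ j → δ j k) ⊖0≡0)
      }
    ; -‿homo = λ a k → refl
    }

module Cyclotomic (p : ℕ) .{{_ : NonZero p}} where

  open Congruence p using (negateₘ; doubleₘ)
  open ZMod p using (⊖-mod; ⊕-mod)
  open GroupRing p
  open Polynomial commutativeRing
  open RingMorphisms (CommutativeRing.rawRing commutativeRing) (CommutativeRing.rawRing commutativeRing)
    using (IsRingHomomorphism)

  -- Defs' operations are, clause for clause, those of Polynomial commutativeRing;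
  -- linFactor p r is definitionally linearₚ (ζ^ p r).
  +P≡+ₚ : ∀ f g → _+P_ p f g ≡ f +ₚ g
  +P≡+ₚ []      g       = refl
  +P≡+ₚ (a ∷ f) []      = refl
  +P≡+ₚ (a ∷ f) (b ∷ g) = cong (_ ∷_) (+P≡+ₚ f g)

  *P≡*ₚ : ∀ f g → _*P_ p f g ≡ f *ₚ g
  *P≡*ₚ []      g = refl
  *P≡*ₚ (a ∷ f) g =
    ≡.trans (+P≡+ₚ (scale a g) (0C p ∷ _*P_ p f g)) (cong (λ h → scale a g +ₚ (0C p ∷ h)) (*P≡*ₚ f g))

  negX≡negXₚ : ∀ f → negX p f ≡ negXₚ f
  negX≡negXₚ []      = refl
  negX≡negXₚ (a ∷ f) = cong (λ h → a ∷ -ₚ h) (negX≡negXₚ f)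

  sqX≡sqXₚ : ∀ f → sqX p f ≡ sqXₚ f
  sqX≡sqXₚ []      = refl
  sqX≡sqXₚ (a ∷ f) = cong (λ h → a ∷ 0C p ∷ h) (sqX≡sqXₚ f)

  prodP≡∏ₚ : ∀ fs → prodP p fs ≡ ∏ₚ fs
  prodP≡∏ₚ []       = refl
  prodP≡∏ₚ (f ∷ fs) = ≡.trans (cong (_*P_ p f) (prodP≡∏ₚ fs)) (*P≡*ₚ f (∏ₚ fs))

  -- Everything is proved for the pointwise equality _≗_, which is finer than _≈C_.
  ≗⇒≈C : ∀ {a b} → a ≗ b → _≈C_ p a b
  ≗⇒≈C a≗b = 0ℤ , λ k → ℤₚ.i≡j⇒i-j≡0 (a≗b k)

  ≈ₚ⇒≈P : ∀ {f g} → f ≈ₚ g → _≈P_ p f g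
  ≈ₚ⇒≈P {[]}    {[]}    _    = tt
  ≈ₚ⇒≈P {[]}    {b ∷ g} []≈g = ≗⇒≈C (λ k → ≡.sym (proj₁ b∷g≈[] k)) , ≈ₚ⇒≈P (≈ₚ-sym (proj₂ b∷g≈[]))
    where
    b∷g≈[] : b ≗ 0C p × g ≈ₚ []
    b∷g≈[] = ∷≈[]⁻¹ (≈ₚ-sym []≈g)
  ≈ₚ⇒≈P {a ∷ f} {[]}    f≈[] = ≗⇒≈C (proj₁ (∷≈[]⁻¹ f≈[])) , ≈ₚ⇒≈P (proj₂ (∷≈[]⁻¹ f≈[]))
  ≈ₚ⇒≈P {a ∷ f} {b ∷ g} f≈g  = ≗⇒≈C (proj₁ (∷-injective f≈g)) , ≈ₚ⇒≈P (proj₂ (∷-injective f≈g))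

  ζ^-∙-ζ^ : ∀ r → ζ^ p r ∙ ζ^ p r ≗ ζ^ p (doubleₘ r)
  ζ^-∙-ζ^ r k = ≡.trans (δ-∙-δ (r mod p) (r mod p) k) (cong (λ j → δ j k) (⊕-mod r))

  conj-ζ^ : ∀ r → conj p (ζ^ p r) ≗ ζ^ p (negateₘ r)
  conj-ζ^ r k = ≡.trans (conj-δ (r mod p) k) (cong (λ j → δ j k) (⊖-mod r))

  linearₚ-cong : ∀ {a b} → a ≗ b → linearₚ a ≈ₚ linearₚ b
  linearₚ-cong a≗b = ∷-cong (λ k → cong ℤ.-_ (a≗b k)) ≈ₚ-refl

  conj-linFactor : ∀ r → map (conj p) (linFactor p r) ≈ₚ linFactor p (negateₘ r)
  conj-linFactor r = ∷-cong (λ k → cong ℤ.-_ (conj-ζ^ r k)) (∷-cong 1#-homo ≈ₚ-refl)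
    where open IsRingHomomorphism conj-isRingHomomorphism using (1#-homo)

  conj-∏linFactor : ∀ rs → map (conj p) (∏ₚ (map (linFactor p) rs)) ≈ₚ ∏ₚ (map (linFactor p) (map negateₘ rs))
  conj-∏linFactor rs = begin
    map (conj p) (∏ₚ (map (linFactor p) rs))
      ≈⟨ ∏ₚ-homo (map (conj p)) (map-*ₚ conj-isRingHomomorphism) (map-1ₚ conj-isRingHomomorphism) (map (linFactor p) rs) ⟩
    ∏ₚ (map (map (conj p)) (map (linFactor p) rs))
      ≡⟨ cong ∏ₚ (map-∘ rs) ⟨
    ∏ₚ (map (map (conj p) ∘ linFactor p) rs)
      ≈⟨ ∏ₚ-map-cong conj-linFactor rs ⟩
    ∏ₚ (map (linFactor p ∘ negateₘ) rs)
      ≡⟨ cong ∏ₚ (map-∘ rs) ⟩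
    ∏ₚ (map (linFactor p) (map negateₘ rs))
      ∎
    where open ≈ₚ-Reasoning

  conj-fixed⇒IsRealPoly : ∀ f → map (conj p) f ≈ₚ f → IsRealPoly p f
  conj-fixed⇒IsRealPoly []      _ = []
  conj-fixed⇒IsRealPoly (a ∷ f) e = ≗⇒≈C (proj₁ (∷-injective e)) ∷ conj-fixed⇒IsRealPoly f (proj₂ (∷-injective e))

  ∏linFactor-real : ∀ rs → map negateₘ rs ↭ rs → IsRealPoly p (prodP p (map (linFactor p) rs))
  ∏linFactor-real rs negation-permutes =
    ≡.subst (IsRealPoly p) (≡.sym (prodP≡∏ₚ (map (linFactor p) rs)))
      (conj-fixed⇒IsRealPoly _ (≈ₚ-trans (conj-∏linFactor rs) (∏ₚ-↭ (map⁺ (linFactor p) negation-permutes))))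

  ∏linFactor-*ₚ-negXₚ : ∀ ns → let f = ∏ₚ (map (linFactor p) ns) in
    f *ₚ negXₚ f ≈ₚ ∏ₚ (map -ₚ_ (map (sqXₚ ∘ linFactor p ∘ doubleₘ) ns))
  ∏linFactor-*ₚ-negXₚ ns = begin
    ∏ₚ (map lin ns) *ₚ negXₚ (∏ₚ (map lin ns))
      ≈⟨ *ₚ-congʳ (∏ₚ (map lin ns)) (∏ₚ-homo negXₚ negXₚ-*ₚ ≈ₚ-refl (map lin ns)) ⟩
    ∏ₚ (map lin ns) *ₚ ∏ₚ (map negXₚ (map lin ns))
      ≡⟨ cong (λ h → ∏ₚ (map lin ns) *ₚ ∏ₚ h) (map-∘ ns) ⟨
    ∏ₚ (map lin ns) *ₚ ∏ₚ (map (negXₚ ∘ lin) ns)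
      ≈⟨ ∏ₚ-map-*ₚ lin (negXₚ ∘ lin) ns ⟩
    ∏ₚ (map (λ n → lin n *ₚ negXₚ (lin n)) ns)
      ≈⟨ ∏ₚ-map-cong (λ n → ≈ₚ-trans (linearₚ-*ₚ-negXₚ (ζ^ p n)) (-ₚ-cong (sqXₚ-cong (linearₚ-cong (ζ^-∙-ζ^ n))))) ns ⟩
    ∏ₚ (map (-ₚ_ ∘ sqXₚ ∘ lin ∘ doubleₘ) ns)
      ≡⟨ cong ∏ₚ (map-∘ ns) ⟩
    ∏ₚ (map -ₚ_ (map (sqXₚ ∘ lin ∘ doubleₘ) ns))
      ∎
    where
    open ≈ₚ-Reasoning
    lin : ℕ → List (Cyc p)
    lin = linFactor p

  sqXₚ-∏linFactor : ∀ rs → sqXₚ (∏ₚ (map (linFactor p) rs)) ≈ₚ ∏ₚ (map (sqXₚ ∘ linFactor p) rs)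
  sqXₚ-∏linFactor rs =
    ≈ₚ-trans (∏ₚ-homo sqXₚ sqXₚ-*ₚ sqXₚ-1ₚ (map (linFactor p) rs)) (≈ₚ-reflexive (cong ∏ₚ (≡.sym (map-∘ rs))))

  sqXₚ-∏linFactor≈∏*negXₚ : ∀ k ns rs → map doubleₘ ns ↭ rs → length ns ≡ k ℕ.+ k →
    let f = ∏ₚ (map (linFactor p) ns) in sqXₚ (∏ₚ (map (linFactor p) rs)) ≈ₚ f *ₚ negXₚ f
  sqXₚ-∏linFactor≈∏*negXₚ k ns rs doubling-permutes ns-even = begin
    sqXₚ (∏ₚ (map lin rs))
      ≈⟨ sqXₚ-∏linFactor rs ⟩
    ∏ₚ (map (sqXₚ ∘ lin) rs)
      ≈⟨ ∏ₚ-↭ (map⁺ (sqXₚ ∘ lin) doubling-permutes) ⟨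
    ∏ₚ (map (sqXₚ ∘ lin) (map doubleₘ ns))
      ≡⟨ cong ∏ₚ (map-∘ ns) ⟨
    ∏ₚ (map (sqXₚ ∘ lin ∘ doubleₘ) ns)
      ≈⟨ ∏ₚ-map--ₚ k (map (sqXₚ ∘ lin ∘ doubleₘ) ns) (≡.trans (length-map _ ns) ns-even) ⟨
    ∏ₚ (map -ₚ_ (map (sqXₚ ∘ lin ∘ doubleₘ) ns))
      ≈⟨ ∏linFactor-*ₚ-negXₚ ns ⟨
    ∏ₚ (map lin ns) *ₚ negXₚ (∏ₚ (map lin ns))
      ∎
    where
    open ≈ₚ-Reasoning
    lin : ℕ → List (Cyc p)
    lin = linFactor p

  sqX-∏linFactor : ∀ k ns rs → map doubleₘ ns ↭ rs → length ns ≡ k ℕ.+ k →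
    let f = prodP p (map (linFactor p) ns) in
    _≈P_ p (sqX p (prodP p (map (linFactor p) rs))) (_*P_ p f (negX p f))
  sqX-∏linFactor k ns rs doubling-permutes ns-even =
    ≡.subst₂ (_≈P_ p) (≡.sym (sqX-bridge (map (linFactor p) rs))) (≡.sym (*negX-bridge (map (linFactor p) ns)))
      (≈ₚ⇒≈P (sqXₚ-∏linFactor≈∏*negXₚ k ns rs doubling-permutes ns-even))
    where
    sqX-bridge : ∀ fs → sqX p (prodP p fs) ≡ sqXₚ (∏ₚ fs)
    sqX-bridge fs = ≡.trans (sqX≡sqXₚ (prodP p fs)) (cong sqXₚ (prodP≡∏ₚ fs))
    *negX-bridge : ∀ fs → _*P_ p (prodP p fs) (negX p (prodP p fs)) ≡ ∏ₚ fs *ₚ negXₚ (∏ₚ fs)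
    *negX-bridge fs = ≡.trans (*P≡*ₚ (prodP p fs) (negX p (prodP p fs)))
      (cong₂ _*ₚ_ (prodP≡∏ₚ fs) (≡.trans (negX≡negXₚ (prodP p fs)) (cong negXₚ (prodP≡∏ₚ fs))))

-- Not opened earlier: these names clash with the ring operations inside Polynomial.
open import Data.Nat using (_+_; _*_; _^_; _∸_; _<_; _≤_; _!; s≤s; z≤n)
open import Data.Nat.Properties
open import Data.Nat.Tactic.RingSolver using (solve-∀)

∈⇒↭∷ : ∀ {A : Set} {y : A} {xs} → y ∈ xs → ∃[ ys ] xs ↭ y ∷ ys
∈⇒↭∷ y∈xs with ys , zs , refl ← ∈-∃++ y∈xs = ys ++ zs , ↭-shift _ ys zs

Unique-resp-↭ : ∀ {A : Set} {xs ys : List A} → xs ↭ ys → Unique xs → Unique ys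
Unique-resp-↭ {A} xs↭ys = PermutationProperties.Unique-resp-↭ (↭⇒↭ₛ xs↭ys)
  where import Data.List.Relation.Binary.Permutation.Setoid.Properties (≡.setoid A) as PermutationProperties

unique-⇔⇒↭ : ∀ {A : Set} {xs ys : List A} → Unique xs → Unique ys → (∀ {x} → x ∈ xs ⇔ x ∈ ys) → xs ↭ ys
unique-⇔⇒↭ xs-unique ys-unique xs⇔ys = ∼bag⇒↭ (unique∧set⇒bag xs-unique ys-unique xs⇔ys)

map-↭ : ∀ {A B : Set} {xs : List A} {ys : List B} (f : A → B) (g : B → A) →
        Unique xs → Unique ys → (∀ {x} → x ∈ xs → f x ∈ ys) → (∀ {y} → y ∈ ys → g y ∈ xs) →
        (∀ {x} → x ∈ xs → g (f x) ≡ x) → (∀ {y} → y ∈ ys → f (g y) ≡ y) → map f xs ↭ ys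
map-↭ {xs = xs} {ys} f g xs-unique ys-unique f∈ g∈ g∘f≡id f∘g≡id =
  unique-⇔⇒↭ (map-unique xs-unique (λ x∈ y∈ fx≡fy → ≡.trans (≡.sym (g∘f≡id x∈)) (≡.trans (cong g fx≡fy) (g∘f≡id y∈))))
    ys-unique (mk⇔ to from)
  where
  map-unique : ∀ {xs} → Unique xs → (∀ {x y} → x ∈ xs → y ∈ xs → f x ≡ f y → x ≡ y) → Unique (map f xs)
  map-unique {[]}     []             _   = []
  map-unique {x ∷ xs} (x∉xs ∷ xs-unique) inj =
    All.map⁺ (All.tabulate (λ y∈ fx≡fy → All.lookup x∉xs y∈ (inj (here refl) (there y∈) fx≡fy)))
    ∷ map-unique xs-unique (λ x∈ y∈ → inj (there x∈) (there y∈))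
  to : ∀ {y} → y ∈ map f xs → y ∈ ys
  to y∈ with x , x∈ , refl ← ∈-map⁻ f y∈ = f∈ x∈
  from : ∀ {y} → y ∈ ys → y ∈ map f xs
  from y∈ = ≡.subst (_∈ map f xs) (f∘g≡id y∈) (∈-map⁺ f (g∈ y∈))

length-filter-⊎ : ∀ {A : Set} {P Q : A → Set} (P? : Decidable P) (Q? : Decidable Q) →
                  (∀ {x} → P x → ¬ Q x) → ∀ {xs} → All (λ x → P x ⊎ Q x) xs →
                  length (filter P? xs) + length (filter Q? xs) ≡ length xs
length-filter-⊎ P? Q? exclusive []                        = refl
length-filter-⊎ P? Q? exclusive {x ∷ xs} (Px⊎Qx ∷ P⊎Q) with P? x | Q? x
... | yes Px  | yes Qx  = contradiction Qx (exclusive Px)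
... | yes _   | no _    = cong suc (length-filter-⊎ P? Q? exclusive P⊎Q)
... | no _    | yes _   = ≡.trans (+-suc _ _) (cong suc (length-filter-⊎ P? Q? exclusive P⊎Q))
... | no ¬Px  | no ¬Qx  = ⊥-elim ([ ¬Px , ¬Qx ]′ Px⊎Qx)

module Residues (n : ℕ) .{{_ : NonZero n}} where

  open Congruence n
  open import Data.List.Membership.Propositional.Properties using (∈-upTo⁺; ∈-upTo⁻)
  open import Data.List.Properties using (length-upTo)

  ∈-residues⁺ : ∀ {x} → ¬ x ≡ₘ 0 → x % n ∈ residues n
  ∈-residues⁺ {x} x≢0 with x % n | m%n<n x n
  ... | zero  | _     = contradiction (≡.sym 0%n≡0) x≢0
  ... | suc i | i+1<n = ∈-map⁺ suc (∈-upTo⁺ (<⇒≤pred i+1<n))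

  ∈-residues⁻ : ∀ {x} → x ∈ residues n → x < n × ¬ x ≡ₘ 0
  ∈-residues⁻ x∈ with ∈-map⁻ suc x∈
  ... | i , i∈ , refl = i+1<n , <n⇒≢ₘ0 (s≤s z≤n) i+1<n
    where
    i+1<n : suc i < n
    i+1<n = ≡.subst (suc i <_) (suc-pred n) (s≤s (∈-upTo⁻ i∈))

  negateₘ<n : ∀ {x} → ¬ x ≡ₘ 0 → negateₘ x < n
  negateₘ<n {x} x≢0 = ∸-monoʳ-< (n≢0⇒n>0 (λ x%n≡0 → x≢0 (≡.trans x%n≡0 (≡.sym 0%n≡0)))) (m%n≤n x n)

  negateₘ-∈ : ∀ {x} → x ∈ residues n → negateₘ x ∈ residues n
  negateₘ-∈ {x} x∈ = ≡.subst (_∈ residues n) (m<n⇒m%n≡m (negateₘ<n x≢0)) (∈-residues⁺ (negateₘ-≢ₘ0 x≢0))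
    where
    x≢0 : ¬ x ≡ₘ 0
    x≢0 = proj₂ (∈-residues⁻ x∈)

  negateₘ-involutive : ∀ {x} → x ∈ residues n → negateₘ (negateₘ x) ≡ x
  negateₘ-involutive {x} x∈ = begin
    n ∸ (n ∸ x % n) % n   ≡⟨ cong (n ∸_) (m<n⇒m%n≡m (negateₘ<n x≢0)) ⟩
    n ∸ (n ∸ x % n)       ≡⟨ m∸[m∸n]≡n (m%n≤n x n) ⟩
    x % n                 ≡⟨ m<n⇒m%n≡m (proj₁ (∈-residues⁻ x∈)) ⟩
    x                     ∎
    where
    open ≡.≡-Reasoning
    x≢0 : ¬ x ≡ₘ 0
    x≢0 = proj₂ (∈-residues⁻ x∈)

  residues-unique : Unique (residues n)
  residues-unique = Unique.map⁺ suc-injective (Unique.upTo⁺ (n ℕ.∸ 1))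

  length-residues : length (residues n) ≡ n ℕ.∸ 1
  length-residues = ≡.trans (length-map suc (upTo (n ℕ.∸ 1))) (length-upTo (n ℕ.∸ 1))

module QuadraticResidues (n : ℕ) .{{_ : NonZero n}} where

  open Congruence n
  open Residues n
  open import Data.Nat using (_≡ᵇ_)
  open import Data.List.Membership.Propositional using (lose)
  open import Data.List.Membership.Propositional.Properties using (∈-upTo⁺)
  open import Data.List.Relation.Unary.Any using (satisfied)
  open import Data.List.Relation.Unary.Any.Properties using (any⁺; any⁻)
  open import Relation.Nullary.Decidable using (Dec; map′; T?; toSum)

  private
    root-test : ℕ → ℕ → Bool
    root-test a x = ((x * x) % n) ≡ᵇ (a % n)

  isSquareMod-sound : ∀ {a} → T (isSquareMod n a) → Square a
  isSquareMod-sound {a} t with x , tx ← satisfied (any⁻ (root-test a) (upTo n) t) = x , ≡ᵇ⇒≡ _ _ tx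

  isSquareMod-complete : ∀ {a} → Square a → T (isSquareMod n a)
  isSquareMod-complete {a} (x , xx≡a) =
    any⁺ (root-test a) (lose (∈-upTo⁺ (m%n<n x n)) (≡⇒≡ᵇ _ _ (≡.trans (*-congₘ (%-≡ₘ x) (%-≡ₘ x)) xx≡a)))

  Square? : ∀ a → Dec (Square a)
  Square? a = map′ isSquareMod-sound isSquareMod-complete (T? (isSquareMod n a))

  legendre-residue : ∀ {x} → x ∈ residues n → legendre x n ≡ (if isSquareMod n x then 1ℤ else -1ℤ)
  legendre-residue {x} x∈ with ∈-map⁻ suc x∈
  ... | i , _ , refl = cong (λ m → if m ≡ᵇ 0 then 0ℤ else (if isSquareMod n (suc i) then 1ℤ else -1ℤ))
                            (m<n⇒m%n≡m (proj₁ (∈-residues⁻ x∈)))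

  legendre-square : ∀ {x} → x ∈ residues n → Square x → legendre x n ≡ 1ℤ
  legendre-square {x} x∈ square with isSquareMod n x in eq | legendre-residue x∈
  ... | true  | legendre≡ = legendre≡
  ... | false | _         = ⊥-elim (≡.subst T eq (isSquareMod-complete square))

  legendre-nonsquare : ∀ {x} → x ∈ residues n → ¬ Square x → legendre x n ≡ -1ℤ
  legendre-nonsquare {x} x∈ nonsquare with isSquareMod n x in eq | legendre-residue x∈
  ... | true  | _         = contradiction (isSquareMod-sound (≡.subst T (≡.sym eq) tt)) nonsquare
  ... | false | legendre≡ = legendre≡

  -- Definitionally the index lists of G n and G* n.
  quadraticResidues nonResidues : List ℕ
  quadraticResidues = filter (λ r → legendre r n ℤ.≟ 1ℤ) (residues n)
  nonResidues       = filter (λ r → legendre r n ℤ.≟ -1ℤ) (residues n)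

  ∈-quadraticResidues⁺ : ∀ {x} → x ∈ residues n → Square x → x ∈ quadraticResidues
  ∈-quadraticResidues⁺ x∈ square = ∈-filter⁺ (λ r → legendre r n ℤ.≟ 1ℤ) x∈ (legendre-square x∈ square)

  ∈-quadraticResidues⁻ : ∀ {x} → x ∈ quadraticResidues → x ∈ residues n × Square x
  ∈-quadraticResidues⁻ {x} x∈ with ∈-filter⁻ (λ r → legendre r n ℤ.≟ 1ℤ) {xs = residues n} x∈
  ... | x∈residues , legendre≡1 with Square? x
  ...   | yes square    = x∈residues , square
  ...   | no nonsquare  = contradiction (≡.trans (≡.sym legendre≡1) (legendre-nonsquare x∈residues nonsquare)) λ ()

  ∈-nonResidues⁺ : ∀ {x} → x ∈ residues n → ¬ Square x → x ∈ nonResidues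
  ∈-nonResidues⁺ x∈ nonsquare = ∈-filter⁺ (λ r → legendre r n ℤ.≟ -1ℤ) x∈ (legendre-nonsquare x∈ nonsquare)

  ∈-nonResidues⁻ : ∀ {x} → x ∈ nonResidues → x ∈ residues n × ¬ Square x
  ∈-nonResidues⁻ {x} x∈ with ∈-filter⁻ (λ r → legendre r n ℤ.≟ -1ℤ) {xs = residues n} x∈
  ... | x∈residues , legendre≡-1 =
    x∈residues , λ square → contradiction (≡.trans (≡.sym legendre≡-1) (legendre-square x∈residues square)) λ ()

  quadraticResidues-unique : Unique quadraticResidues
  quadraticResidues-unique = Unique.filter⁺ (λ r → legendre r n ℤ.≟ 1ℤ) residues-unique

  nonResidues-unique : Unique nonResidues
  nonResidues-unique = Unique.filter⁺ (λ r → legendre r n ℤ.≟ -1ℤ) residues-unique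

  length-quadraticResidues+nonResidues : length quadraticResidues + length nonResidues ≡ length (residues n)
  length-quadraticResidues+nonResidues =
    length-filter-⊎ (λ r → legendre r n ℤ.≟ 1ℤ) (λ r → legendre r n ℤ.≟ -1ℤ) (λ ≡1 ≡-1 → contradiction (≡.trans (≡.sym ≡1) ≡-1) λ ())
      (All.tabulate λ {x} x∈ → [ inj₁ ∘ legendre-square x∈ , inj₂ ∘ legendre-nonsquare x∈ ]′ (toSum (Square? x)))

module Pairing (n : ℕ) .{{_ : NonZero n}} where

  open Congruence n
  open import Data.List.Relation.Unary.Unique.Propositional.Properties using (Unique[x∷xs]⇒x∉xs)

  record PairedBy (σ : ℕ → ℕ) (a : ℕ) (xs : List ℕ) : Set where
    field
      unique        : Unique xs
      closed        : ∀ {x} → x ∈ xs → σ x ∈ xs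
      involutive    : ∀ {x} → x ∈ xs → σ (σ x) ≡ x
      fixpoint-free : ∀ {x} → x ∈ xs → σ x ≢ x
      pair-product  : ∀ {x} → x ∈ xs → x * σ x ≡ₘ a

  paired-rest : ∀ {σ a x xs rest} → PairedBy σ a (x ∷ xs) → xs ↭ σ x ∷ rest → PairedBy σ a rest
  paired-rest {σ} {a} {x} {xs} {rest} P xs↭ = record
    { unique        = tail-unique
    ; closed        = rest-closed
    ; involutive    = involutive ∘ rest⊆
    ; fixpoint-free = fixpoint-free ∘ rest⊆
    ; pair-product  = pair-product ∘ rest⊆
    }
    where
    open PairedBy P
    x∷xs-unique : Unique (x ∷ xs)
    x∷xs-unique = unique
    σx∷rest-unique : Unique (σ x ∷ rest)
    σx∷rest-unique with _ ∷ xs-unique ← x∷xs-unique = Unique-resp-↭ xs↭ xs-unique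
    tail-unique : Unique rest
    tail-unique with _ ∷ rest-unique ← σx∷rest-unique = rest-unique
    rest⊆xs : ∀ {y} → y ∈ rest → y ∈ xs
    rest⊆xs y∈rest = ∈-resp-↭ (↭-sym xs↭) (there y∈rest)
    rest⊆ : ∀ {y} → y ∈ rest → y ∈ x ∷ xs
    rest⊆ = there ∘ rest⊆xs
    rest-closed : ∀ {y} → y ∈ rest → σ y ∈ rest
    rest-closed {y} y∈rest with closed (rest⊆ y∈rest)
    ... | here σy≡x = contradiction (≡.subst (_∈ rest) y≡σx y∈rest) (Unique[x∷xs]⇒x∉xs σx∷rest-unique)
      where
      y≡σx : y ≡ σ x
      y≡σx = ≡.trans (≡.sym (involutive (rest⊆ y∈rest))) (cong σ σy≡x)
    ... | there σy∈xs with ∈-resp-↭ xs↭ σy∈xs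
    ...   | there σy∈rest = σy∈rest
    ...   | here σy≡σx = contradiction (≡.subst (_∈ xs) y≡x (rest⊆xs y∈rest)) (Unique[x∷xs]⇒x∉xs x∷xs-unique)
      where
      y≡x : y ≡ x
      y≡x = ≡.trans (≡.sym (involutive (rest⊆ y∈rest))) (≡.trans (cong σ σy≡σx) (involutive (here refl)))

  product-paired : ∀ {σ a} m xs → length xs ≡ m → PairedBy σ a xs → ∃[ k ] k + k ≡ m × product xs ≡ₘ a ^ k
  product-paired zero    []       _   _ = 0 , refl , refl
  product-paired (suc zero) (x ∷ []) _ P with PairedBy.closed P (here refl)
  ... | here σx≡x = contradiction σx≡x (PairedBy.fixpoint-free P (here refl))
  product-paired {σ} {a} (suc (suc m)) (x ∷ xs) len P with PairedBy.closed P (here refl)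
  ... | here σx≡x   = contradiction σx≡x (PairedBy.fixpoint-free P (here refl))
  ... | there σx∈xs with ∈⇒↭∷ σx∈xs
  ...   | rest , xs↭ with product-paired m rest (suc-injective (≡.trans (≡.sym (↭-length xs↭)) (suc-injective len)))
                                            (paired-rest P xs↭)
  ...     | k , k+k≡m , rest≡ = suc k , cong suc (≡.trans (+-suc k k) (cong suc k+k≡m)) , (begin
    x * product xs              ≡⟨ cong (x *_) (product-↭ xs↭) ⟩
    x * (σ x * product rest)    ≡⟨ *-assoc x (σ x) (product rest) ⟨
    x * σ x * product rest      ≈⟨ *-congₘ (PairedBy.pair-product P (here refl)) rest≡ ⟩
    a * a ^ k                   ∎)
    where open ≡ₘ-Reasoning

module PrimeField (p : ℕ) .{{_ : NonZero p}} (p-prime : Prime p) where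

  open Congruence p
  open import Data.Nat using (≢-nonZero)
  open import Data.Nat.Coprimality using (prime⇒coprime; coprime-Bézout)
  open import Data.Nat.GCD using (module Bézout)
  open import Relation.Nullary using (Dec)

  infix 4 _≟ₘ_
  _≟ₘ_ : ∀ a b → Dec (a ≡ₘ b)
  a ≟ₘ b = a % p ℕ.≟ b % p

  *p≡ₘ0 : ∀ x → x * p ≡ₘ 0
  *p≡ₘ0 x = ≡.trans (*-congₘ {x} refl n≡ₘ0) (cong (_% p) (*-zeroʳ x))

  ∃-inverse : ∀ {a} → ¬ a ≡ₘ 0 → ∃[ b ] a * b ≡ₘ 1
  ∃-inverse {a} a≢0 with coprime-Bézout (prime⇒coprime p-prime {{≢-nonZero a%p≢0}} (m%n<n a p))
    where
    a%p≢0 : a % p ≢ 0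
    a%p≢0 a%p≡0 = a≢0 (≡.trans a%p≡0 (≡.sym 0%n≡0))
  ... | Bézout.-+ x y 1+xp≡ya = y , (begin
    a * y              ≈⟨ *-congₘ (≡.sym (%-≡ₘ a)) (refl {x = y % p}) ⟩
    a % p * y          ≡⟨ *-comm (a % p) y ⟩
    y * (a % p)        ≡⟨ 1+xp≡ya ⟨
    1 + x * p          ≈⟨ +-congₘ {1} refl (*p≡ₘ0 x) ⟩
    1                  ∎)
    where open ≡ₘ-Reasoning
  ... | Bézout.+- x y 1+ya≡xp = y * -1ₘ , (begin
    a * (y * -1ₘ)          ≈⟨ *-congₘ (≡.sym (%-≡ₘ a)) (refl {x = (y * -1ₘ) % p}) ⟩
    a % p * (y * -1ₘ)      ≡⟨ rearrange (a % p) y -1ₘ ⟩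
    y * (a % p) * -1ₘ      ≈⟨ *-congₘ ya≡-1 (refl {x = -1ₘ % p}) ⟩
    -1ₘ * -1ₘ              ≈⟨ -1ₘ*-1ₘ≡ₘ1 ⟩
    1                      ∎)
    where
    open ≡ₘ-Reasoning
    rearrange : ∀ a y z → a * (y * z) ≡ y * a * z
    rearrange = solve-∀
    ya≡-1 : y * (a % p) ≡ₘ -1ₘ
    ya≡-1 = +-cancelˡ-≡ₘ 1 (≡.trans (≡.trans (cong (_% p) 1+ya≡xp) (*p≡ₘ0 x)) (≡.sym (≡.trans (cong (_% p) 1+-1ₘ≡n) n≡ₘ0)))

  inverse : ℕ → ℕ
  inverse a with a ≟ₘ 0
  ... | yes _   = 0
  ... | no a≢0 = proj₁ (∃-inverse a≢0)

  *-inverseʳ : ∀ {a} → ¬ a ≡ₘ 0 → a * inverse a ≡ₘ 1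
  *-inverseʳ {a} a≢0 with a ≟ₘ 0
  ... | yes a≡0  = contradiction a≡0 a≢0
  ... | no a≢0′ = proj₂ (∃-inverse a≢0′)

  *-cancelˡ-≡ₘ : ∀ {a x y} → ¬ a ≡ₘ 0 → a * x ≡ₘ a * y → x ≡ₘ y
  *-cancelˡ-≡ₘ {a} {x} {y} a≢0 ax≡ay = begin
    x                      ≡⟨ *-identityˡ x ⟨
    1 * x                  ≈⟨ *-congₘ (≡.sym (*-inverseʳ a≢0)) (refl {x = x % p}) ⟩
    a * inverse a * x      ≡⟨ rearrange a (inverse a) x ⟩
    inverse a * (a * x)    ≈⟨ *-congₘ (refl {x = inverse a % p}) ax≡ay ⟩
    inverse a * (a * y)    ≡⟨ rearrange a (inverse a) y ⟨
    a * inverse a * y      ≈⟨ *-congₘ (*-inverseʳ a≢0) (refl {x = y % p}) ⟩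
    1 * y                  ≡⟨ *-identityˡ y ⟩
    y                      ∎
    where
    open ≡ₘ-Reasoning
    rearrange : ∀ a b x → a * b * x ≡ b * (a * x)
    rearrange = solve-∀

  *-≢ₘ0 : ∀ {a b} → ¬ a ≡ₘ 0 → ¬ b ≡ₘ 0 → ¬ a * b ≡ₘ 0
  *-≢ₘ0 {a} {b} a≢0 b≢0 ab≡0 = b≢0 (*-cancelˡ-≡ₘ a≢0 (≡.trans ab≡0 (cong (_% p) (≡.sym (*-zeroʳ a)))))

  square-roots-≤ : ∀ {x y} → y ≤ x → x * x ≡ₘ y * y → x ≡ₘ y ⊎ x + y ≡ₘ 0
  square-roots-≤ {x} {y} y≤x xx≡yy with m≤n⇒∃[o]m+o≡n y≤x
  ... | d , refl with (y + d) + y ≟ₘ 0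
  ...   | yes x+y≡0 = inj₂ x+y≡0
  ...   | no  x+y≢0 = inj₁ (begin
    y + d   ≈⟨ +-congₘ {y} refl d≡0 ⟩
    y + 0   ≡⟨ +-identityʳ y ⟩
    y       ∎)
    where
    open ≡ₘ-Reasoning
    expand : ∀ y d → (y + d) * (y + d) ≡ y * y + d * (y + d + y)
    expand = solve-∀
    d[x+y]≡0 : d * (y + d + y) ≡ₘ 0
    d[x+y]≡0 = +-cancelˡ-≡ₘ (y * y) (begin
      y * y + d * (y + d + y)   ≡⟨ expand y d ⟨
      (y + d) * (y + d)         ≈⟨ xx≡yy ⟩
      y * y                     ≡⟨ +-identityʳ (y * y) ⟨
      y * y + 0                 ∎)
    d≡0 : d ≡ₘ 0
    d≡0 = *-cancelˡ-≡ₘ x+y≢0 (≡.trans (≡⇒≡ₘ (*-comm (y + d + y) d))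
                               (≡.trans d[x+y]≡0 (≡⇒≡ₘ (≡.sym (*-zeroʳ (y + d + y))))))

  square-roots : ∀ {x y} → x * x ≡ₘ y * y → x ≡ₘ y ⊎ x + y ≡ₘ 0
  square-roots {x} {y} xx≡yy with ≤-total y x
  ... | inj₁ y≤x = square-roots-≤ y≤x xx≡yy
  ... | inj₂ x≤y with square-roots-≤ x≤y (≡.sym xx≡yy)
  ...   | inj₁ y≡x   = inj₁ (≡.sym y≡x)
  ...   | inj₂ y+x≡0 = inj₂ (≡.trans (≡⇒≡ₘ (+-comm x y)) y+x≡0)

m+m≡n+n⇒m≡n : ∀ {m n} → m + m ≡ n + n → m ≡ n
m+m≡n+n⇒m≡n {m} {n} e = ≡.trans (n≡⌊n+n/2⌋ m) (≡.trans (cong ℕ.⌊_/2⌋ e) (≡.sym (n≡⌊n+n/2⌋ n)))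

[a*b]^k≡a^k*b^k : ∀ a b k → (a * b) ^ k ≡ a ^ k * b ^ k
[a*b]^k≡a^k*b^k a b zero    = refl
[a*b]^k≡a^k*b^k a b (suc k) = ≡.trans (cong (a * b *_) ([a*b]^k≡a^k*b^k a b k)) (interchange a b (a ^ k) (b ^ k))
  where
  interchange : ∀ a b c d → a * b * (c * d) ≡ a * c * (b * d)
  interchange = solve-∀

evenProduct : ℕ → ℕ
evenProduct zero    = 1
evenProduct (suc m) = 2 * suc m * evenProduct m

oddProduct : ℕ → ℕ
oddProduct zero    = 1
oddProduct (suc m) = suc (2 * m) * oddProduct m

descendingEvenProduct : ℕ → ℕ → ℕ
descendingEvenProduct b zero    = 1
descendingEvenProduct b (suc m) = 2 * (b ∸ m) * descendingEvenProduct b m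

evenProduct≡2^m*m! : ∀ m → evenProduct m ≡ 2 ^ m * m !
evenProduct≡2^m*m! zero    = refl
evenProduct≡2^m*m! (suc m) = ≡.trans (cong (2 * suc m *_) (evenProduct≡2^m*m! m)) (rearrange (suc m) (2 ^ m) (m !))
  where
  rearrange : ∀ x y z → 2 * x * (y * z) ≡ 2 * y * (x * z)
  rearrange = solve-∀

evenProduct*oddProduct≡[m+m]! : ∀ m → evenProduct m * oddProduct m ≡ (m + m) !
evenProduct*oddProduct≡[m+m]! zero    = refl
evenProduct*oddProduct≡[m+m]! (suc m) = begin
  2 * suc m * evenProduct m * (suc (2 * m) * oddProduct m)
    ≡⟨ rearrange m (evenProduct m) (oddProduct m) ⟩
  suc (suc (m + m)) * (suc (m + m) * (evenProduct m * oddProduct m))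
    ≡⟨ cong (λ x → suc (suc (m + m)) * (suc (m + m) * x)) (evenProduct*oddProduct≡[m+m]! m) ⟩
  suc (suc (m + m)) !
    ≡⟨ cong (λ x → suc x !) (+-suc m m) ⟨
  (suc m + suc m) !
    ∎
  where
  open ≡.≡-Reasoning
  rearrange : ∀ m d e → 2 * suc m * d * (suc (2 * m) * e) ≡ suc (suc (m + m)) * (suc (m + m) * (d * e))
  rearrange = solve-∀

evenProduct-split : ∀ {m b} → m ≤ b → evenProduct b ≡ descendingEvenProduct b m * evenProduct (b ∸ m)
evenProduct-split {zero}  {b} _   = ≡.sym (*-identityˡ (evenProduct b))
evenProduct-split {suc m} {b} m<b = begin
  evenProduct b
    ≡⟨ evenProduct-split (<⇒≤ m<b) ⟩
  descendingEvenProduct b m * evenProduct (b ∸ m)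
    ≡⟨ cong (λ x → descendingEvenProduct b m * evenProduct x) (+-∸-assoc 1 m<b) ⟩
  descendingEvenProduct b m * (2 * suc (b ∸ suc m) * evenProduct (b ∸ suc m))
    ≡⟨ cong (λ x → descendingEvenProduct b m * (2 * x * evenProduct (b ∸ suc m))) (+-∸-assoc 1 m<b) ⟨
  descendingEvenProduct b m * (2 * (b ∸ m) * evenProduct (b ∸ suc m))
    ≡⟨ rearrange (descendingEvenProduct b m) (b ∸ m) (evenProduct (b ∸ suc m)) ⟩
  2 * (b ∸ m) * descendingEvenProduct b m * evenProduct (b ∸ suc m)
    ∎
  where
  open ≡.≡-Reasoning
  rearrange : ∀ x y z → x * (2 * y * z) ≡ 2 * y * x * z
  rearrange = solve-∀

module Gauss (n : ℕ) .{{_ : NonZero n}} (h : ℕ) (n≡2h+1 : n ≡ suc (h + h)) where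

  open Congruence n

  2[h∸m]≡ₘ-[2m+1] : ∀ {m} → m ≤ h → 2 * (h ∸ m) ≡ₘ -1ₘ * suc (2 * m)
  2[h∸m]≡ₘ-[2m+1] {m} m≤h = +-cancelʳ-≡ₘ (suc (2 * m)) (begin
    2 * (h ∸ m) + suc (2 * m)    ≡⟨ rearrange (h ∸ m) m ⟩
    suc (h ∸ m + m + (h ∸ m + m)) ≡⟨ cong (λ x → suc (x + x)) (m∸n+n≡m m≤h) ⟩
    suc (h + h)                  ≡⟨ n≡2h+1 ⟨
    n                            ≈⟨ n≡ₘ0 ⟩
    0                            ≈⟨ ≡.sym (-1ₘ*a+a≡ₘ0 (suc (2 * m))) ⟩
    -1ₘ * suc (2 * m) + suc (2 * m) ∎)
    where
    open ≡ₘ-Reasoning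
    rearrange : ∀ x m → 2 * x + suc (2 * m) ≡ suc (x + m + (x + m))
    rearrange = solve-∀

  descendingEvenProduct≡ₘ : ∀ {m} → m ≤ h → descendingEvenProduct h m ≡ₘ -1ₘ ^ m * oddProduct m
  descendingEvenProduct≡ₘ {zero}  _   = refl
  descendingEvenProduct≡ₘ {suc m} m<h = begin
    2 * (h ∸ m) * descendingEvenProduct h m
      ≈⟨ *-congₘ (2[h∸m]≡ₘ-[2m+1] (<⇒≤ m<h)) (descendingEvenProduct≡ₘ (<⇒≤ m<h)) ⟩
    -1ₘ * suc (2 * m) * (-1ₘ ^ m * oddProduct m)
      ≡⟨ rearrange -1ₘ (suc (2 * m)) (-1ₘ ^ m) (oddProduct m) ⟩
    -1ₘ * -1ₘ ^ m * (suc (2 * m) * oddProduct m)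
      ∎
    where
    open ≡ₘ-Reasoning
    rearrange : ∀ a b c d → a * b * (c * d) ≡ a * c * (b * d)
    rearrange = solve-∀

  2^h*h!≡ₘ : ∀ j → h ≡ j + j → 2 ^ h * h ! ≡ₘ -1ₘ ^ j * h !
  2^h*h!≡ₘ j h≡j+j = begin
    2 ^ h * h !
      ≡⟨ evenProduct≡2^m*m! h ⟨
    evenProduct h
      ≡⟨ evenProduct-split j≤h ⟩
    descendingEvenProduct h j * evenProduct (h ∸ j)
      ≡⟨ cong (λ x → descendingEvenProduct h j * evenProduct x) h∸j≡j ⟩
    descendingEvenProduct h j * evenProduct j
      ≈⟨ *-congₘ (descendingEvenProduct≡ₘ j≤h) (refl {x = evenProduct j % n}) ⟩
    -1ₘ ^ j * oddProduct j * evenProduct j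
      ≡⟨ rearrange (-1ₘ ^ j) (oddProduct j) (evenProduct j) ⟩
    -1ₘ ^ j * (evenProduct j * oddProduct j)
      ≡⟨ cong (λ x → -1ₘ ^ j * x) (≡.trans (evenProduct*oddProduct≡[m+m]! j) (cong _! (≡.sym h≡j+j))) ⟩
    -1ₘ ^ j * h !
      ∎
    where
    open ≡ₘ-Reasoning
    rearrange : ∀ a b c → a * b * c ≡ a * (c * b)
    rearrange = solve-∀
    j≤h : j ≤ h
    j≤h = ≡.subst (j ≤_) (≡.sym h≡j+j) (m≤m+n j j)
    h∸j≡j : h ∸ j ≡ j
    h∸j≡j = ≡.trans (cong (_∸ j) h≡j+j) (m+n∸n≡m j j)

module OddPrime (p : ℕ) .{{_ : NonZero p}} (p-prime : Prime p) (h : ℕ) (p≡2h+1 : p ≡ suc (h + h)) where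

  open Congruence p
  open PrimeField p p-prime
  open Residues p
  open Pairing p
  open QuadraticResidues p using (Square?)
  open import Data.Nat.Primality using (prime⇒nonTrivial)

  1<p : 1 < p
  1<p = ℕ.nonTrivial⇒n>1 p {{prime⇒nonTrivial p-prime}}

  2<p : 2 < p
  2<p = ≤∧≢⇒< 1<p (λ 2≡p → 1≢m+m h (suc-injective (≡.trans 2≡p p≡2h+1)))
    where
    1≢m+m : ∀ m → 1 ≢ m + m
    1≢m+m zero    ()
    1≢m+m (suc m) 1≡ = 0≢1+n (≡.trans (suc-injective 1≡) (+-suc m m))

  1≢ₘ0 : ¬ 1 ≡ₘ 0
  1≢ₘ0 = <n⇒≢ₘ0 (s≤s z≤n) 1<p

  2≢ₘ0 : ¬ 2 ≡ₘ 0
  2≢ₘ0 = <n⇒≢ₘ0 (s≤s z≤n) 2<p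

  length-residues≡h+h : length (residues p) ≡ h + h
  length-residues≡h+h = ≡.trans length-residues (cong (_∸ 1) p≡2h+1)

  inverse≢ₘ0 : ∀ {x} → ¬ x ≡ₘ 0 → ¬ inverse x ≡ₘ 0
  inverse≢ₘ0 {x} x≢0 inv≡0 = 1≢ₘ0 (begin
    1                ≈⟨ *-inverseʳ x≢0 ⟨
    x * inverse x    ≈⟨ *-congₘ (refl {x = x % p}) inv≡0 ⟩
    x * 0            ≡⟨ *-zeroʳ x ⟩
    0                ∎)
    where open ≡ₘ-Reasoning

  partner : ℕ → ℕ → ℕ
  partner a x = (a * inverse x) % p

  nonroots : ℕ → List ℕ
  nonroots a = filter (λ x → ¬? (x * x ≟ₘ a)) (residues p)

  ∈-nonroots⁻ : ∀ {a x} → x ∈ nonroots a → x ∈ residues p × ¬ x * x ≡ₘ a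
  ∈-nonroots⁻ {a} = ∈-filter⁻ (λ x → ¬? (x * x ≟ₘ a)) {xs = residues p}

  ∈-nonroots⁺ : ∀ {a x} → x ∈ residues p → ¬ x * x ≡ₘ a → x ∈ nonroots a
  ∈-nonroots⁺ {a} = ∈-filter⁺ (λ x → ¬? (x * x ≟ₘ a))

  nonroots-unique : ∀ a → Unique (nonroots a)
  nonroots-unique a = Unique.filter⁺ (λ x → ¬? (x * x ≟ₘ a)) residues-unique

  module _ {a} (a≢0 : ¬ a ≡ₘ 0) where

    partner-product : ∀ {x} → ¬ x ≡ₘ 0 → x * partner a x ≡ₘ a
    partner-product {x} x≢0 = begin
      x * ((a * inverse x) % p)   ≈⟨ *-congₘ (refl {x = x % p}) (%-≡ₘ (a * inverse x)) ⟩
      x * (a * inverse x)         ≡⟨ rearrange x a (inverse x) ⟩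
      a * (x * inverse x)         ≈⟨ *-congₘ (refl {x = a % p}) (*-inverseʳ x≢0) ⟩
      a * 1                       ≡⟨ *-identityʳ a ⟩
      a                           ∎
      where
      open ≡ₘ-Reasoning
      rearrange : ∀ x a i → x * (a * i) ≡ a * (x * i)
      rearrange = solve-∀

    partner-∈ : ∀ {x} → x ∈ residues p → partner a x ∈ residues p
    partner-∈ x∈ = ∈-residues⁺ (*-≢ₘ0 a≢0 (inverse≢ₘ0 (proj₂ (∈-residues⁻ x∈))))

    partner-unique : ∀ {x y} → x ∈ residues p → y < p → x * y ≡ₘ a → partner a x ≡ y
    partner-unique {x} {y} x∈ y<p xy≡a = ≡ₘ⇒≡ (m%n<n _ p) y<p
      (*-cancelˡ-≡ₘ x≢0 (≡.trans (partner-product x≢0) (≡.sym xy≡a)))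
      where x≢0 = proj₂ (∈-residues⁻ x∈)

    partner-involutive : ∀ {x} → x ∈ residues p → partner a (partner a x) ≡ x
    partner-involutive {x} x∈ = partner-unique (partner-∈ x∈) (proj₁ (∈-residues⁻ x∈))
      (≡.trans (≡⇒≡ₘ (*-comm (partner a x) x)) (partner-product (proj₂ (∈-residues⁻ x∈))))

    partner-fixed⇒root : ∀ {x} → x ∈ residues p → partner a x ≡ x → x * x ≡ₘ a
    partner-fixed⇒root {x} x∈ σx≡x = ≡.trans (≡⇒≡ₘ (cong (x *_) (≡.sym σx≡x))) (partner-product (proj₂ (∈-residues⁻ x∈)))

    root⇒partner-fixed : ∀ {x} → x ∈ residues p → x * x ≡ₘ a → partner a x ≡ x
    root⇒partner-fixed x∈ xx≡a = partner-unique x∈ (proj₁ (∈-residues⁻ x∈)) xx≡a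

    nonroots-paired : PairedBy (partner a) a (nonroots a)
    nonroots-paired = record
      { unique        = nonroots-unique a
      ; closed        = nonroots-closed
      ; involutive    = partner-involutive ∘ residue
      ; fixpoint-free = λ x∈ σx≡x → nonroot x∈ (partner-fixed⇒root (residue x∈) σx≡x)
      ; pair-product  = partner-product ∘ proj₂ ∘ ∈-residues⁻ ∘ residue
      }
      where
      residue : ∀ {x} → x ∈ nonroots a → x ∈ residues p
      residue x∈ = proj₁ (∈-nonroots⁻ x∈)
      nonroot : ∀ {x} → x ∈ nonroots a → ¬ x * x ≡ₘ a
      nonroot x∈ = proj₂ (∈-nonroots⁻ x∈)
      nonroots-closed : ∀ {x} → x ∈ nonroots a → partner a x ∈ nonroots a
      nonroots-closed {x} x∈ = ∈-nonroots⁺ (partner-∈ (residue x∈)) σx-nonroot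
        where
        σx-nonroot : ¬ partner a x * partner a x ≡ₘ a
        σx-nonroot σx-root = nonroot x∈ (partner-fixed⇒root (residue x∈) (≡.sym x≡σx))
          where
          x≡σx : x ≡ partner a x
          x≡σx = ≡.trans (≡.sym (partner-involutive (residue x∈))) (root⇒partner-fixed (partner-∈ (residue x∈)) σx-root)

  product-nonroots : ∀ {a} → ¬ a ≡ₘ 0 → ∃[ k ] k + k ≡ length (nonroots a) × product (nonroots a) ≡ₘ a ^ k
  product-nonroots {a} a≢0 = product-paired _ (nonroots a) refl (nonroots-paired a≢0)

  product-residues-nonsquare : ∀ {a} → ¬ Square a → product (residues p) ≡ₘ a ^ h
  product-residues-nonsquare {a} nonsquare with product-nonroots (¬Square⇒≢ₘ0 nonsquare)
  ... | k , k+k≡|nonroots| , product≡ = begin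
    product (residues p)  ≡⟨ cong product nonroots≡residues ⟨
    product (nonroots a)  ≈⟨ product≡ ⟩
    a ^ k                 ≡⟨ cong (a ^_) k≡h ⟩
    a ^ h                 ∎
    where
    open ≡ₘ-Reasoning
    nonroots≡residues : nonroots a ≡ residues p
    nonroots≡residues = filter-all (λ x → ¬? (x * x ≟ₘ a)) (All.tabulate λ {x} _ xx≡a → nonsquare (x , xx≡a))
    k≡h : k ≡ h
    k≡h = m+m≡n+n⇒m≡n (≡.trans k+k≡|nonroots| (≡.trans (cong length nonroots≡residues) length-residues≡h+h))

  module _ {a s} (ss≡a : s * s ≡ₘ a) (a≢0 : ¬ a ≡ₘ 0) where

    private
      r₁ r₂ : ℕ
      r₁ = s % p
      r₂ = negateₘ s % p

    s≢0 : ¬ s ≡ₘ 0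
    s≢0 s≡0 = a≢0 (≡.trans (≡.sym ss≡a) (*-congₘ s≡0 s≡0))

    r₁-root : r₁ * r₁ ≡ₘ a
    r₁-root = ≡.trans (*-congₘ (%-≡ₘ s) (%-≡ₘ s)) ss≡a

    r₂-root : r₂ * r₂ ≡ₘ a
    r₂-root = begin
      r₂ * r₂                        ≈⟨ *-congₘ (%-≡ₘ (negateₘ s)) (%-≡ₘ (negateₘ s)) ⟩
      negateₘ s * negateₘ s          ≈⟨ *-congₘ (negateₘ≡ₘ-1ₘ* s) (negateₘ≡ₘ-1ₘ* s) ⟩
      -1ₘ * s * (-1ₘ * s)            ≡⟨ rearrange -1ₘ s ⟩
      -1ₘ * -1ₘ * (s * s)            ≈⟨ *-congₘ -1ₘ*-1ₘ≡ₘ1 ss≡a ⟩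
      1 * a                          ≡⟨ *-identityˡ a ⟩
      a                              ∎
      where
      open ≡ₘ-Reasoning
      rearrange : ∀ m s → m * s * (m * s) ≡ m * m * (s * s)
      rearrange = solve-∀

    r₁*r₂≡ₘ-a : r₁ * r₂ ≡ₘ -1ₘ * a
    r₁*r₂≡ₘ-a = begin
      r₁ * r₂                   ≈⟨ *-congₘ (%-≡ₘ s) (%-≡ₘ (negateₘ s)) ⟩
      s * negateₘ s             ≈⟨ *-congₘ (refl {x = s % p}) (negateₘ≡ₘ-1ₘ* s) ⟩
      s * (-1ₘ * s)             ≡⟨ rearrange s -1ₘ ⟩
      -1ₘ * (s * s)             ≈⟨ *-congₘ (refl {x = -1ₘ % p}) ss≡a ⟩
      -1ₘ * a                   ∎
      where
      open ≡ₘ-Reasoning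
      rearrange : ∀ s m → s * (m * s) ≡ m * (s * s)
      rearrange = solve-∀

    r₁≢r₂ : r₁ ≢ r₂
    r₁≢r₂ r₁≡r₂ = s≢0 (*-cancelˡ-≡ₘ 2≢ₘ0 (begin
      2 * s              ≡⟨ cong (s +_) (+-identityʳ s) ⟩
      s + s              ≈⟨ +-congₘ {s} refl s≡-s ⟩
      s + negateₘ s      ≈⟨ +-inverseₘ s ⟩
      0                  ≡⟨ *-zeroʳ 2 ⟨
      2 * 0              ∎))
      where
      open ≡ₘ-Reasoning
      s≡-s : s ≡ₘ negateₘ s
      s≡-s = ≡.trans (≡.sym (%-≡ₘ s)) (≡.trans (cong (_% p) r₁≡r₂) (%-≡ₘ (negateₘ s)))

    root∉nonroots : ∀ {r} → r * r ≡ₘ a → All (r ≢_) (nonroots a)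
    root∉nonroots {r} root = All.tabulate λ y∈ r≡y → proj₂ (∈-nonroots⁻ y∈) (≡.subst (λ y → y * y ≡ₘ a) r≡y root)

    residues↭roots∷nonroots : residues p ↭ r₁ ∷ r₂ ∷ nonroots a
    residues↭roots∷nonroots = unique-⇔⇒↭ residues-unique
      ((r₁≢r₂ All.∷ root∉nonroots r₁-root) ∷ root∉nonroots r₂-root ∷ nonroots-unique a) (mk⇔ to from)
      where
      to : ∀ {x} → x ∈ residues p → x ∈ r₁ ∷ r₂ ∷ nonroots a
      to {x} x∈ with x * x ≟ₘ a
      ... | no nonroot = there (there (∈-nonroots⁺ x∈ nonroot))
      ... | yes root with square-roots (≡.trans root (≡.sym ss≡a))
      ...   | inj₁ x≡s   = here (≡ₘ⇒≡ (proj₁ (∈-residues⁻ x∈)) (m%n<n s p) (≡.trans x≡s (≡.sym (%-≡ₘ s))))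
      ...   | inj₂ x+s≡0 = there (here (≡ₘ⇒≡ (proj₁ (∈-residues⁻ x∈)) (m%n<n (negateₘ s) p)
                             (≡.trans x≡-s (≡.sym (%-≡ₘ (negateₘ s))))))
        where
        x≡-s : x ≡ₘ negateₘ s
        x≡-s = +-cancelʳ-≡ₘ s (≡.trans x+s≡0 (≡.sym (≡.trans (≡⇒≡ₘ (+-comm (negateₘ s) s)) (+-inverseₘ s))))
      from : ∀ {x} → x ∈ r₁ ∷ r₂ ∷ nonroots a → x ∈ residues p
      from (here refl)         = ∈-residues⁺ s≢0
      from (there (here refl)) = ∈-residues⁺ (negateₘ-≢ₘ0 s≢0)
      from (there (there x∈))  = proj₁ (∈-nonroots⁻ x∈)

    product-residues-square : product (residues p) ≡ₘ -1ₘ * a ^ h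
    product-residues-square with product-nonroots a≢0
    ... | k , k+k≡|nonroots| , product≡ = begin
      product (residues p)                  ≡⟨ product-↭ residues↭roots∷nonroots ⟩
      r₁ * (r₂ * product (nonroots a))      ≡⟨ *-assoc r₁ r₂ _ ⟨
      r₁ * r₂ * product (nonroots a)        ≈⟨ *-congₘ r₁*r₂≡ₘ-a product≡ ⟩
      -1ₘ * a * a ^ k                       ≡⟨ *-assoc -1ₘ a (a ^ k) ⟩
      -1ₘ * a ^ suc k                       ≡⟨ cong (λ e → -1ₘ * a ^ e) 1+k≡h ⟩
      -1ₘ * a ^ h                           ∎
      where
      open ≡ₘ-Reasoning
      1+k≡h : suc k ≡ h
      1+k≡h = m+m≡n+n⇒m≡n (≡.trans (cong suc (+-suc k k)) (≡.trans (cong (suc ∘ suc) k+k≡|nonroots|)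
                (≡.trans (≡.sym (↭-length residues↭roots∷nonroots)) length-residues≡h+h)))

  -1ₘ≢ₘ0 : ¬ -1ₘ ≡ₘ 0
  -1ₘ≢ₘ0 = <n⇒≢ₘ0 (m<n⇒0<n∸m 1<p) (∸-monoʳ-< (s≤s z≤n) (<⇒≤ 1<p))

  -1ₘ≢ₘ1 : ¬ -1ₘ ≡ₘ 1
  -1ₘ≢ₘ1 -1≡1 = 2≢ₘ0 (≡.trans (+-congₘ {1} refl (≡.sym -1≡1)) (≡.trans (≡⇒≡ₘ 1+-1ₘ≡n) n≡ₘ0))

  wilson : product (residues p) ≡ₘ -1ₘ
  wilson = ≡.trans (product-residues-square {1} {1} refl 1≢ₘ0) (≡⇒≡ₘ (≡.trans (cong (-1ₘ *_) (^-zeroˡ h)) (*-identityʳ -1ₘ)))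

  euler-square : ∀ {a} → Square a → ¬ a ≡ₘ 0 → a ^ h ≡ₘ 1
  euler-square {a} (s , ss≡a) a≢0 = *-cancelˡ-≡ₘ -1ₘ≢ₘ0
    (≡.trans (≡.sym (product-residues-square {a} {s} ss≡a a≢0)) (≡.trans wilson (≡⇒≡ₘ (≡.sym (*-identityʳ -1ₘ)))))

  euler-nonsquare : ∀ {a} → ¬ Square a → a ^ h ≡ₘ -1ₘ
  euler-nonsquare nonsquare = ≡.trans (≡.sym (product-residues-nonsquare nonsquare)) wilson

  nonsquare*nonsquare : ∀ {a b} → ¬ Square a → ¬ Square b → Square (a * b)
  nonsquare*nonsquare {a} {b} a-nonsquare b-nonsquare with Square? (a * b)
  ... | yes ab-square    = ab-square
  ... | no ab-nonsquare = contradiction (begin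
    -1ₘ                    ≈⟨ euler-nonsquare ab-nonsquare ⟨
    (a * b) ^ h            ≡⟨ [a*b]^k≡a^k*b^k a b h ⟩
    a ^ h * b ^ h          ≈⟨ *-congₘ (euler-nonsquare a-nonsquare) (euler-nonsquare b-nonsquare) ⟩
    -1ₘ * -1ₘ              ≈⟨ -1ₘ*-1ₘ≡ₘ1 ⟩
    1                      ∎) -1ₘ≢ₘ1
    where open ≡ₘ-Reasoning

  square*nonsquare : ∀ {a b} → Square a → ¬ a ≡ₘ 0 → ¬ Square b → ¬ Square (a * b)
  square*nonsquare {a} {b} a-square a≢0 b-nonsquare ab-square = -1ₘ≢ₘ1 (begin
    -1ₘ                    ≡⟨ *-identityˡ -1ₘ ⟨
    1 * -1ₘ                ≈⟨ *-congₘ (euler-square a-square a≢0) (euler-nonsquare b-nonsquare) ⟨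
    a ^ h * b ^ h          ≡⟨ [a*b]^k≡a^k*b^k a b h ⟨
    (a * b) ^ h            ≈⟨ euler-square ab-square (*-≢ₘ0 a≢0 (¬Square⇒≢ₘ0 b-nonsquare)) ⟩
    1                      ∎)
    where open ≡ₘ-Reasoning

  m!≢ₘ0 : ∀ {m} → m < p → ¬ m ! ≡ₘ 0
  m!≢ₘ0 {zero}  _   = 1≢ₘ0
  m!≢ₘ0 {suc m} m<p = *-≢ₘ0 (<n⇒≢ₘ0 (s≤s z≤n) m<p) (m!≢ₘ0 (<⇒≤ m<p))

module FiveModEight (p : ℕ) .{{_ : NonZero p}} (p-prime : Prime p) (p≡5 : p % 8 ≡ 5) where

  -- p = 8m + 5 = 4j + 1 with j = 2m + 1 odd, and h = (p − 1)/2.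
  j h : ℕ
  j = suc (p / 8 + p / 8)
  h = j + j

  p≡2h+1 : p ≡ suc (h + h)
  p≡2h+1 = ≡.trans (m≡m%n+[m/n]*n p 8) (≡.trans (cong (_+ p / 8 * 8) p≡5) (expand (p / 8)))
    where
    expand : ∀ m → 5 + m * 8 ≡ suc (suc (m + m) + suc (m + m) + (suc (m + m) + suc (m + m)))
    expand = solve-∀

  open Congruence p
  open PrimeField p p-prime
  open Residues p
  open QuadraticResidues p
  open OddPrime p p-prime h p≡2h+1
  open Gauss p h p≡2h+1

  2^h≡ₘ-1 : 2 ^ h ≡ₘ -1ₘ
  2^h≡ₘ-1 = *-cancelˡ-≡ₘ (m!≢ₘ0 h<p) (begin
    h ℕ.! * 2 ^ h              ≡⟨ *-comm (h ℕ.!) (2 ^ h) ⟩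
    2 ^ h * h ℕ.!              ≈⟨ 2^h*h!≡ₘ j refl ⟩
    -1ₘ ^ j * h ℕ.!            ≈⟨ *-congₘ -1ₘ^j≡ₘ-1ₘ (refl {x = h ℕ.! % p}) ⟩
    -1ₘ * h ℕ.!                ≡⟨ *-comm -1ₘ (h ℕ.!) ⟩
    h ℕ.! * -1ₘ                ∎)
    where
    open ≡ₘ-Reasoning
    h<p : h < p
    h<p = ≡.subst (h <_) (≡.sym p≡2h+1) (s≤s (m≤m+n h h))
    -1ₘ^j≡ₘ-1ₘ : -1ₘ ^ j ≡ₘ -1ₘ
    -1ₘ^j≡ₘ-1ₘ = ≡.trans (*-congₘ (refl {x = -1ₘ % p}) (-1ₘ^[m+m]≡ₘ1 (p / 8))) (≡⇒≡ₘ (*-identityʳ -1ₘ))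

  -1ₘ-square : Square -1ₘ
  -1ₘ-square with Square? -1ₘ
  ... | yes square    = square
  ... | no nonsquare = contradiction (≡.trans (≡.sym (euler-nonsquare nonsquare)) (-1ₘ^[m+m]≡ₘ1 j)) -1ₘ≢ₘ1

  2-nonsquare : ¬ Square 2
  2-nonsquare square = -1ₘ≢ₘ1 (≡.trans (≡.sym 2^h≡ₘ-1) (euler-square square 2≢ₘ0))

  negation-permutes : map negateₘ quadraticResidues ↭ quadraticResidues
  negation-permutes = map-↭ negateₘ negateₘ quadraticResidues-unique quadraticResidues-unique
    negateₘ-∈-QR negateₘ-∈-QR involutive involutive
    where
    involutive : ∀ {x} → x ∈ quadraticResidues → negateₘ (negateₘ x) ≡ x
    involutive = negateₘ-involutive ∘ proj₁ ∘ ∈-quadraticResidues⁻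
    negateₘ-∈-QR : ∀ {x} → x ∈ quadraticResidues → negateₘ x ∈ quadraticResidues
    negateₘ-∈-QR {x} x∈ with x∈residues , x-square ← ∈-quadraticResidues⁻ x∈ =
      ∈-quadraticResidues⁺ (negateₘ-∈ x∈residues) (Square-resp (≡.sym (negateₘ≡ₘ-1ₘ* x)) (Square-* -1ₘ-square x-square))

  -- Multiplication by (p + 1)/2, the inverse of 2.
  halveₘ : ℕ → ℕ
  halveₘ y = (y * suc h) % p

  2*[1+h]≡ₘ1 : 2 * suc h ≡ₘ 1
  2*[1+h]≡ₘ1 = ≡.trans (≡⇒≡ₘ (≡.trans (expand h) (cong suc (≡.sym p≡2h+1)))) (+-congₘ {1} refl n≡ₘ0)
    where
    expand : ∀ h → 2 * suc h ≡ suc (suc (h + h))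
    expand = solve-∀

  2*halveₘ≡ₘ : ∀ y → 2 * halveₘ y ≡ₘ y
  2*halveₘ≡ₘ y = begin
    2 * ((y * suc h) % p)    ≈⟨ *-congₘ (refl {x = 2 % p}) (%-≡ₘ (y * suc h)) ⟩
    2 * (y * suc h)          ≡⟨ rearrange y (suc h) ⟩
    y * (2 * suc h)          ≈⟨ *-congₘ (refl {x = y % p}) 2*[1+h]≡ₘ1 ⟩
    y * 1                    ≡⟨ *-identityʳ y ⟩
    y                        ∎
    where
    open ≡ₘ-Reasoning
    rearrange : ∀ y k → 2 * (y * k) ≡ y * (2 * k)
    rearrange = solve-∀

  halveₘ-doubleₘ : ∀ {x} → x ∈ residues p → halveₘ (doubleₘ x) ≡ x
  halveₘ-doubleₘ {x} x∈ = ≡ₘ⇒≡ (m%n<n _ p) (proj₁ (∈-residues⁻ x∈)) (*-cancelˡ-≡ₘ 2≢ₘ0 (begin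
    2 * halveₘ (doubleₘ x)   ≈⟨ 2*halveₘ≡ₘ (doubleₘ x) ⟩
    doubleₘ x                ≈⟨ doubleₘ≡ₘ2* x ⟩
    2 * x                    ∎))
    where open ≡ₘ-Reasoning

  doubleₘ-halveₘ : ∀ {y} → y ∈ residues p → doubleₘ (halveₘ y) ≡ y
  doubleₘ-halveₘ {y} y∈ = ≡ₘ⇒≡ (m%n<n _ p) (proj₁ (∈-residues⁻ y∈)) (≡.trans (doubleₘ≡ₘ2* (halveₘ y)) (2*halveₘ≡ₘ y))

  doubling-permutes : map doubleₘ nonResidues ↭ quadraticResidues
  doubling-permutes = map-↭ doubleₘ halveₘ nonResidues-unique quadraticResidues-unique doubleₘ-∈ halveₘ-∈
    (halveₘ-doubleₘ ∘ proj₁ ∘ ∈-nonResidues⁻) (doubleₘ-halveₘ ∘ proj₁ ∘ ∈-quadraticResidues⁻)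
    where
    doubleₘ-∈ : ∀ {x} → x ∈ nonResidues → doubleₘ x ∈ quadraticResidues
    doubleₘ-∈ {x} x∈ with x∈residues , x-nonsquare ← ∈-nonResidues⁻ x∈ =
      ∈-quadraticResidues⁺ (∈-residues⁺ (λ x+x≡0 → *-≢ₘ0 2≢ₘ0 x≢0 (≡.trans (≡.sym (doubleₘ≡ₘ2* x)) (≡.trans (%-≡ₘ (x + x)) x+x≡0))))
        (Square-resp (≡.sym (doubleₘ≡ₘ2* x)) (nonsquare*nonsquare 2-nonsquare x-nonsquare))
      where x≢0 = proj₂ (∈-residues⁻ x∈residues)
    halveₘ-∈ : ∀ {y} → y ∈ quadraticResidues → halveₘ y ∈ nonResidues
    halveₘ-∈ {y} y∈ with y∈residues , y-square ← ∈-quadraticResidues⁻ y∈ =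
      ∈-nonResidues⁺ (∈-residues⁺ y*[1+h]≢0) halveₘy-nonsquare
      where
      y*[1+h]≢0 : ¬ y * suc h ≡ₘ 0
      y*[1+h]≢0 = *-≢ₘ0 (proj₂ (∈-residues⁻ y∈residues))
        (λ 1+h≡0 → 1≢ₘ0 (≡.trans (≡.sym 2*[1+h]≡ₘ1) (≡.trans (*-congₘ (refl {x = 2 % p}) 1+h≡0) (≡⇒≡ₘ (*-zeroʳ 2)))))
      halveₘy-nonsquare : ¬ Square (halveₘ y)
      halveₘy-nonsquare square = square*nonsquare square (λ e → y*[1+h]≢0 (≡.trans (≡.sym (%-≡ₘ _)) e)) 2-nonsquare
        (Square-resp (≡.trans (≡.sym (2*halveₘ≡ₘ y)) (≡⇒≡ₘ (*-comm 2 (halveₘ y)))) y-square)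

  length-nonResidues : length nonResidues ≡ j + j
  length-nonResidues = m+m≡n+n⇒m≡n (≡.trans (cong (_+ length nonResidues) (≡.sym |QR|≡|NR|))
    (≡.trans length-quadraticResidues+nonResidues length-residues≡h+h))
    where
    |QR|≡|NR| : length quadraticResidues ≡ length nonResidues
    |QR|≡|NR| = ≡.trans (≡.sym (↭-length doubling-permutes)) (length-map doubleₘ nonResidues)

lemma2p2 : (p : ℕ) → .{{_ : NonZero p}} → Prime p → p % 8 ≡ 5 →
    IsRealPoly p (G p) × _≈P_ p (sqX p (G p)) (_*P_ p (G* p) (negX p (G* p)))
lemma2p2 p p-prime p≡5 =
  ∏linFactor-real quadraticResidues negation-permutes ,
  sqX-∏linFactor j nonResidues quadraticResidues doubling-permutes length-nonResidues
  where
  open FiveModEight p p-prime p≡5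
  open QuadraticResidues p using (quadraticResidues; nonResidues)
  open Cyclotomic p using (∏linFactor-real; sqX-∏linFactor)
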